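{- A flat disunification problem $\Gamma_0$ (whose dissubsumptions have a single atom on the right-hand side) has a local solution iff there is a successful run of the goal-oriented algorithm below on $\Gamma_0$.
   Context: $\mathcal{EL}$ concept terms are built from concept names $N_C$ and role names $N_R$ using $C\sqcap D$, $\exists r.C$ and $\top$; $C\sqsubseteq D$ means $C^{\mathcal I}\subseteq D^{\mathcal I}$ in every interpretation. An atom is a concept name or existential restriction; flat if it is a concept name or $\exists r.A$ with $A$ a concept name. $N_C$ is partitioned into variables and constants; ground = no variables. A flat disunification problem is a finite set of subsumptions $C_1\sqcap\dots\sqcap C_n\sqsubseteq^? D$ and dissubsumptions $C_1\sqcap\dots\sqcap C_n\not\sqsubseteq^? D_1\sqcap\dots\sqcap D_m$ of flat atoms over a fixed finite signature; a solution is a substitution (variables to ground terms) satisfying $\sigma(C)\sqsubseteq\sigma(D)$ resp. $\sigma(C)\not\sqsubseteq\sigma(D)$. $\mathsf{At}$ = atoms occurring as subterms of $\Gamma_0$, $\mathsf{Var}$ = variables occurring, $\mathsf{At_{nv}}=\mathsf{At}\setminus\mathsf{Var}$. An assignment gives each variable $X$ a set $S_X\subseteq\mathsf{At_{nv}}$; $>_S$ is the transitive closure of $\{(X,Y)\mid Y\text{ occurs in an atom of }S_X\}$; $S$ is acyclic if $>_S$ is irreflexive, in which case $\sigma_S(X):=\sigma_S(D_1)\sqcap\dots\sqcap\sigma_S(D_k)$ for $S_X=\{D_1,\dots,D_k\}$ ($\top$ if empty), defined inductively along $>_S$. A local solution is a solution of the form $\sigma_S$ for an acyclic assignment $S$.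 Algorithm: maintain $\Gamma:=\Gamma_0$, assignment $S$ (initially all $S_X=\emptyset$), and a solved/unsolved mark per element. Subsumptions $C_1\sqcap\dots\sqcap C_n\sqsubseteq^? X$ and dissubsumptions $X\not\sqsubseteq^? D$ ($X$ a variable, $D$ a non-variable atom) are "initially solved"; all others start unsolved. Expanding $\Gamma$ w.r.t. $X$ adds $C_1\sqcap\dots\sqcap C_n\sqsubseteq^? E$ for every initially solved $C_1\sqcap\dots\sqcap C_n\sqsubseteq^? X$ and $E\in S_X$, and $E\not\sqsubseteq^? D$ for every $X\not\sqsubseteq^? D\in\Gamma$ and $E\in S_X$ (only if not present; new elements unsolved unless of initially solved form). Eager rules: (Eager Ground Solving) ground $C_1\sqcap\dots\sqcap C_n\bowtie^? D$, $\bowtie\in\{\sqsubseteq,\not\sqsubseteq\}$: mark solved if it holds, else fail. (Eager Solving) $C_1\sqcap\dots\sqcap C_n\bowtie^? D$ with some $C_i=D$ or $C_i$ a variable with $D\in S_{C_i}$: if $\bowtie$ is $\sqsubseteq$ mark solved, else fail. (Eager Extension) $C_1\sqcap\dots\sqcap C_n\sqsubseteq^? D$ with a variable $C_i$ and $\{C_1,\dots,C_n\}\setminus\{C_i\}\subseteq S_{C_i}$: add $D$ to $S_{C_i}$, fail if cyclic, else expand w.r.t. $C_i$ and mark solved. (Eager Top Solving) $C\not\sqsubseteq^?\top$: fail. (Eager Left Decomposition) $C_1\sqcap\dots\sqcap C_n\not\sqsubseteq^? D$, $n\ne1$, $D$ non-variable atom: mark solved, add $C_i\not\sqsubseteq^?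 D$ for each $i$, expanding w.r.t. $C_i$ if it is a variable. (Eager Atomic Decomposition) $C\not\sqsubseteq^? D$ for non-variable atoms: (a) both ground and $C\sqsubseteq D$: fail; (b) both ground and $C\not\sqsubseteq D$: mark solved; (c) $C$ or $D$ a constant: mark solved; (d) $\exists r.C'$ vs $\exists s.D'$, $r\ne s$: mark solved; (e) $\exists r.C'$ vs $\exists r.D'$: add $C'\not\sqsubseteq^? D'$, expand w.r.t. $C'$ if $C'$ is a variable and $D'$ is not, mark solved. Nondeterministic rules: (Decomposition) $C_1\sqcap\dots\sqcap C_n\sqsubseteq^?\exists s.D$ with some $C_i=\exists s.C$: choose $i$, add $C\sqsubseteq^? D$, expand w.r.t. $D$ if a variable, mark solved. (Extension) $C_1\sqcap\dots\sqcap C_n\sqsubseteq^? D$ with a variable $C_i$: choose $i$, add $D$ to $S_{C_i}$, fail if cyclic, else expand w.r.t. $C_i$ and mark solved. (Local Extension) $C\not\sqsubseteq^? X$, $X$ a variable: choose a non-variable atom $D$, add it to $S_X$, fail if cyclic, else add $C\not\sqsubseteq^? D$, expand w.r.t. $X$ (and w.r.t. $C$ if a variable), mark solved. Loop: while some element is unsolved, apply an eager rule to an unsolved element if possible (failure ⇒ return failure); otherwise pick an unsolved element and apply a nondeterministic rule to it (return failure if none applies or it fails). When all elements are solved, return $\sigma_S$. -}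

module Defs where

open import Level using (0ℓ)
open import Data.Nat as ℕ using (ℕ)
open import Data.Bool using (T; Bool; true; false; if_then_else_; _∧_; not)
open import Data.Unit using (⊤)
open import Data.Empty using (⊥)
open import Data.Product using (Σ; ∃; _×_; _,_)
open import Data.Sum using (_⊎_)
open import Data.List using (List; []; _∷_; _++_; [_]; map; concatMap; foldl; filter; length)
open import Data.List.Properties using (≡-dec)
open import Data.List.Membership.Propositional using (_∈_; _∉_)
import Data.List.Membership.DecPropositional as DecMem
open import Relation.Nullary.Decidable using (T?)
open import Relation.Nullary using (¬_; Dec; yes; no; does)
open import Relation.Binary.PropositionalEquality using (_≡_; _≢_; refl; cong; cong₂)
open import Relation.Binary.Definitions using (DecidableEquality)
open import Relation.Binary.Construct.Closure.Transitive using (TransClosure)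

data CName : Set where
  var : ℕ → CName
  con : ℕ → CName

RName : Set
RName = ℕ

data Concept : Set where
  ⊤c  : Concept
  nm  : CName → Concept
  _⊓_ : Concept → Concept → Concept
  ∃c  : RName → Concept → Concept

data Ground : Concept → Set where
  g⊤  : Ground ⊤c
  gcon : ∀ c → Ground (nm (con c))
  g⊓  : ∀ {C D} → Ground C → Ground D → Ground (C ⊓ D)
  g∃  : ∀ {r C} → Ground C → Ground (∃c r C)

record Interp : Set₁ where
  field
    Δ   : Set
    cI  : CName → Δ → Set
    rI  : RName → Δ → Δ → Set

⟦_⟧ : Concept → (I : Interp) → Interp.Δ I → Set
⟦ ⊤c ⟧ I x = ⊤
⟦ nm A ⟧ I x = Interp.cI I A x
⟦ C ⊓ D ⟧ I x = ⟦ C ⟧ I x × ⟦ D ⟧ I x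
⟦ ∃c r C ⟧ I x = Σ (Interp.Δ I) λ y → Interp.rI I r x y × ⟦ C ⟧ I y

_⊑_ : Concept → Concept → Set₁
C ⊑ D = (I : Interp) (x : Interp.Δ I) → ⟦ C ⟧ I x → ⟦ D ⟧ I x

data FAtom : Set where
  at : CName → FAtom
  ex : RName → CName → FAtom

⨅ : List Concept → Concept
⨅ [] = ⊤c
⨅ (C ∷ []) = C
⨅ (C ∷ Cs@(_ ∷ _)) = C ⊓ ⨅ Cs

atomC : FAtom → Concept
atomC (at A) = nm A
atomC (ex r A) = ∃c r (nm A)

data IsVarAtom : FAtom → Set where
  isVar : ∀ X → IsVarAtom (at (var X))

NonVar : FAtom → Set
NonVar a = ¬ IsVarAtom a

data GroundAtom : FAtom → Set where
  gAt : ∀ c → GroundAtom (at (con c))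
  gEx : ∀ r c → GroundAtom (ex r (con c))

data OccursIn (Y : ℕ) : FAtom → Set where
  occAt : OccursIn Y (at (var Y))
  occEx : ∀ r → OccursIn Y (ex r (var Y))

-- Elements of a (flat) disunification problem:
--   sub Cs D   :  C₁ ⊓ ... ⊓ Cₙ ⊑? D
--   dis Cs Ds  :  C₁ ⊓ ... ⊓ Cₙ ⋢? D₁ ⊓ ... ⊓ Dₘ
data Elem : Set where
  sub : List FAtom → FAtom → Elem
  dis : List FAtom → List FAtom → Elem

Problem : Set
Problem = List Elem

_≟N_ : DecidableEquality CName
var x ≟N var y with x ℕ.≟ y
... | yes refl = yes refl
... | no p = no λ { refl → p refl }
var x ≟N con y = no λ ()
con x ≟N var y = no λ ()
con x ≟N con y with x ℕ.≟ y
... | yes refl = yes refl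
... | no p = no λ { refl → p refl }

_≟A_ : DecidableEquality FAtom
at A ≟A at B with A ≟N B
... | yes refl = yes refl
... | no p = no λ { refl → p refl }
at A ≟A ex s B = no λ ()
ex r A ≟A at B = no λ ()
ex r A ≟A ex s B with r ℕ.≟ s | A ≟N B
... | yes refl | yes refl = yes refl
... | no p | _ = no λ { refl → p refl }
... | _ | no p = no λ { refl → p refl }

_≟As_ : DecidableEquality (List FAtom)
_≟As_ = ≡-dec _≟A_

_≟E_ : DecidableEquality Elem
sub Cs D ≟E sub Cs' D' with Cs ≟As Cs' | D ≟A D'
... | yes refl | yes refl = yes refl
... | no p | _ = no λ { refl → p refl }
... | _ | no p = no λ { refl → p refl }
sub _ _ ≟E dis _ _ = no λ ()
dis _ _ ≟E sub _ _ = no λ ()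
dis Cs Ds ≟E dis Cs' Ds' with Cs ≟As Cs' | Ds ≟As Ds'
... | yes refl | yes refl = yes refl
... | no p | _ = no λ { refl → p refl }
... | _ | no p = no λ { refl → p refl }

data SubAtom : FAtom → FAtom → Set where
  self : ∀ {a} → SubAtom a a
  inEx : ∀ {r A} → SubAtom (at A) (ex r A)

data AtomOf : FAtom → Elem → Set where
  subL : ∀ {a Cs D} → a ∈ Cs → AtomOf a (sub Cs D)
  subR : ∀ {Cs D} → AtomOf D (sub Cs D)
  disL : ∀ {a Cs Ds} → a ∈ Cs → AtomOf a (dis Cs Ds)
  disR : ∀ {a Cs Ds} → a ∈ Ds → AtomOf a (dis Cs Ds)

InAt : Problem → FAtom → Set
InAt Γ₀ a = Σ Elem λ e → e ∈ Γ₀ × Σ FAtom λ b → AtomOf b e × SubAtom a b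

InVar : Problem → ℕ → Set
InVar Γ₀ X = InAt Γ₀ (at (var X))

InAtNv : Problem → FAtom → Set
InAtNv Γ₀ a = InAt Γ₀ a × NonVar a

Subst : Set
Subst = ℕ → Concept

GroundSubst : Subst → Set
GroundSubst σ = ∀ X → Ground (σ X)

applyA : Subst → FAtom → Concept
applyA σ (at (var X)) = σ X
applyA σ (at (con c)) = nm (con c)
applyA σ (ex r (var X)) = ∃c r (σ X)
applyA σ (ex r (con c)) = ∃c r (nm (con c))

applyL : Subst → List FAtom → Concept
applyL σ Cs = ⨅ (map (applyA σ) Cs)

Solves : Subst → Elem → Set₁
Solves σ (sub Cs D) = applyL σ Cs ⊑ applyA σ D
Solves σ (dis Cs Ds) = ¬ (applyL σ Cs ⊑ applyL σ Ds)

IsSolution : Problem → Subst → Set₁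
IsSolution Γ₀ σ = GroundSubst σ × (∀ e → e ∈ Γ₀ → Solves σ e)

Assignment : Set
Assignment = ℕ → List FAtom

IsAssignment : Problem → Assignment → Set
IsAssignment Γ₀ S = ∀ X → (InVar Γ₀ X → ∀ a → a ∈ S X → InAtNv Γ₀ a)
                          × (¬ InVar Γ₀ X → S X ≡ [])

_▷[_]_ : ℕ → Assignment → ℕ → Set
X ▷[ S ] Y = Σ FAtom λ E → E ∈ S X × OccursIn Y E

Acyclic : Assignment → Set
Acyclic S = ∀ X → ¬ TransClosure (λ X Y → X ▷[ S ] Y) X X

-- σ is σ_S: σ(X) = σ(D₁) ⊓ ... ⊓ σ(Dₖ) for S_X = {D₁,...,Dₖ} (⊤ if empty),
-- for every X ∈ Var  (for acyclic S this determines σ on Var uniquely)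
IsσS : Problem → Assignment → Subst → Set
IsσS Γ₀ S σ = ∀ X → InVar Γ₀ X → σ X ≡ applyL σ (S X)

HasLocalSolution : Problem → Set₁
HasLocalSolution Γ₀ =
  Σ Assignment λ S → IsAssignment Γ₀ S × Acyclic S ×
    Σ Subst λ σ → IsσS Γ₀ S σ × IsSolution Γ₀ σ

record State : Set where
  constructor ⟨_,_,_⟩
  field
    Γ   : List Elem
    Sol : List Elem
    S   : Assignment
open State public

isVarB : FAtom → Bool
isVarB (at (var _)) = true
isVarB _ = false

initSolved : Elem → Bool
initSolved (sub _ (at (var _))) = true
initSolved (dis (at (var _) ∷ []) (D ∷ [])) = if isVarB D then false else true
initSolved _ = false

module _ where
  open DecMem _≟E_ renaming (_∈?_ to _∈E?_)
  open DecMem _≟A_ renaming (_∈?_ to _∈A?_)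

  addE : Elem → State → State
  addE e ⟨ Γ , Sol , S ⟩ with does (e ∈E? Γ)
  ... | true = ⟨ Γ , Sol , S ⟩
  ... | false = ⟨ Γ ++ [ e ] , (if initSolved e then Sol ++ [ e ] else Sol) , S ⟩

  markSolved : Elem → State → State
  markSolved e ⟨ Γ , Sol , S ⟩ = ⟨ Γ , Sol ++ [ e ] , S ⟩

  addS : ℕ → FAtom → Assignment → Assignment
  addS X D S Y with does (Y ℕ.≟ X) | does (D ∈A? S Y)
  ... | true | false = S Y ++ [ D ]
  ... | _ | _ = S Y

  setS : Assignment → State → State
  setS S' ⟨ Γ , Sol , S ⟩ = ⟨ Γ , Sol , S' ⟩

  expandNew : ℕ → List FAtom → List Elem → List Elem
  expandNew X SX = concatMap f
    where
    f : Elem → List Elem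
    f (sub Cs (at (var Y))) = if does (Y ℕ.≟ X) then map (sub Cs) SX else []
    f (dis (at (var Y) ∷ []) (D ∷ [])) =
      if does (Y ℕ.≟ X) then (if isVarB D then [] else map (λ E → dis [ E ] [ D ]) SX) else []
    f _ = []

  expand : ℕ → State → State
  expand X st = foldl (λ s e → addE e s) st (expandNew X (S st X) (Γ st))

  expandIfVar : FAtom → State → State
  expandIfVar (at (var X)) st = expand X st
  expandIfVar _ st = st

  expandIfVarL : List FAtom → State → State
  expandIfVarL (at (var X) ∷ []) st = expand X st
  expandIfVarL _ st = st

  leftDec : FAtom → List FAtom → State → State
  leftDec D Cs st = foldl (λ s C → expandIfVar C (addE (dis [ C ] [ D ]) s)) st Cs

  expandDec : CName → CName → State → State
  expandDec C' D' st =
    if isVarB (at C') ∧ not (isVarB (at D')) then expandIfVar (at C') st else st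

GroundElem : Elem → Set
GroundElem (sub Cs D) = (∀ a → a ∈ Cs → GroundAtom a) × GroundAtom D
GroundElem (dis Cs Ds) = (∀ a → a ∈ Cs → GroundAtom a) × (∀ a → a ∈ Ds → GroundAtom a)

SolvCond : Assignment → List FAtom → FAtom → Set
SolvCond S Cs D = Σ FAtom λ C → C ∈ Cs × (C ≡ D ⊎ Σ ℕ λ X → C ≡ at (var X) × D ∈ S X)

SolvApp : Assignment → Elem → Set
SolvApp S (sub Cs D) = SolvCond S Cs D
SolvApp S (dis Cs (D ∷ [])) = SolvCond S Cs D
SolvApp S (dis Cs _) = ⊥

ExtCond : Assignment → List FAtom → ℕ → Set
ExtCond S Cs X = at (var X) ∈ Cs × (∀ C → C ∈ Cs → C ≡ at (var X) ⊎ C ∈ S X)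

ExtApp : Assignment → Elem → Set
ExtApp S (sub Cs D) = Σ ℕ (ExtCond S Cs)
ExtApp S (dis _ _) = ⊥

TopApp : Elem → Set
TopApp (dis _ []) = ⊤
TopApp _ = ⊥

LDApp : Elem → Set
LDApp (dis Cs (D ∷ [])) = length Cs ≢ 1 × NonVar D
LDApp _ = ⊥

ADApp : Elem → Set
ADApp (dis (C ∷ []) (D ∷ [])) = NonVar C × NonVar D
ADApp _ = ⊥

EagerApplicable : State → Elem → Set
EagerApplicable st e =
  GroundElem e ⊎ SolvApp (S st) e ⊎ ExtApp (S st) e ⊎ TopApp e ⊎ LDApp e ⊎ ADApp e

Unsolved : State → Elem → Set
Unsolved st e = e ∈ Γ st × e ∉ Sol st

HoldsGround : Elem → Set₁
HoldsGround (sub Cs D) = ⨅ (map atomC Cs) ⊑ atomC D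
HoldsGround (dis Cs Ds) = ¬ (⨅ (map atomC Cs) ⊑ ⨅ (map atomC Ds))

-- Successful applications of the eager rule applicable to e (the first
-- applicable rule in the listed order; failing applications have no
-- constructor, since they terminate the run with failure)
data EagerOK (Γ₀ : Problem) (st : State) : Elem → State → Set₁ where
  groundSolving : ∀ {e} → GroundElem e → HoldsGround e →
    EagerOK Γ₀ st e (markSolved e st)
  solving : ∀ {Cs D} → ¬ GroundElem (sub Cs D) → SolvCond (S st) Cs D →
    EagerOK Γ₀ st (sub Cs D) (markSolved (sub Cs D) st)
  extension : ∀ {Cs D X} → ¬ GroundElem (sub Cs D) → ¬ SolvCond (S st) Cs D →
    ExtCond (S st) Cs X → Acyclic (addS X D (S st)) →
    EagerOK Γ₀ st (sub Cs D)
      (markSolved (sub Cs D) (expand X (setS (addS X D (S st)) st)))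
  leftDecomposition : ∀ {Cs D} → let e = dis Cs (D ∷ []) in
    ¬ GroundElem e → ¬ SolvApp (S st) e → length Cs ≢ 1 → NonVar D →
    EagerOK Γ₀ st e (markSolved e (leftDec D Cs st))
  atomicDecB : ∀ {C D} → let e = dis (C ∷ []) (D ∷ []) in
    ¬ GroundElem e → ¬ SolvApp (S st) e → NonVar C → NonVar D →
    GroundAtom C → GroundAtom D → ¬ (atomC C ⊑ atomC D) →
    EagerOK Γ₀ st e (markSolved e st)
  atomicDecC : ∀ {C D} → let e = dis (C ∷ []) (D ∷ []) in
    ¬ GroundElem e → ¬ SolvApp (S st) e → NonVar C → NonVar D →
    ¬ (GroundAtom C × GroundAtom D) →
    (Σ ℕ λ c → C ≡ at (con c)) ⊎ (Σ ℕ λ c → D ≡ at (con c)) →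
    EagerOK Γ₀ st e (markSolved e st)
  atomicDecD : ∀ {r s C' D'} → let e = dis (ex r C' ∷ []) (ex s D' ∷ []) in
    ¬ GroundElem e → ¬ SolvApp (S st) e →
    ¬ (GroundAtom (ex r C') × GroundAtom (ex s D')) → r ≢ s →
    EagerOK Γ₀ st e (markSolved e st)
  atomicDecE : ∀ {r C' D'} → let e = dis (ex r C' ∷ []) (ex r D' ∷ []) in
    ¬ GroundElem e → ¬ SolvApp (S st) e →
    ¬ (GroundAtom (ex r C') × GroundAtom (ex r D')) →
    EagerOK Γ₀ st e
      (markSolved e
        (expandDec C' D' (addE (dis [ at C' ] [ at D' ]) st)))

data NondetOK (Γ₀ : Problem) (st : State) : Elem → State → Set₁ where
  decomposition : ∀ {Cs s C D} → ex s C ∈ Cs →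
    NondetOK Γ₀ st (sub Cs (ex s D))
      (markSolved (sub Cs (ex s D))
        (expandIfVar (at D) (addE (sub [ at C ] (at D)) st)))
  extension : ∀ {Cs D X} → at (var X) ∈ Cs → Acyclic (addS X D (S st)) →
    NondetOK Γ₀ st (sub Cs D)
      (markSolved (sub Cs D) (expand X (setS (addS X D (S st)) st)))
  localExtension : ∀ {Cs X D} → InAtNv Γ₀ D → Acyclic (addS X D (S st)) →
    NondetOK Γ₀ st (dis Cs (at (var X) ∷ []))
      (markSolved (dis Cs (at (var X) ∷ []))
        (expandIfVarL Cs (expand X
          (addE (dis Cs [ D ]) (setS (addS X D (S st)) st)))))

data Step (Γ₀ : Problem) (st : State) : State → Set₁ where
  eagerStep : ∀ {e st'} → Unsolved st e → EagerOK Γ₀ st e st' → Step Γ₀ st st'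
  nondetStep : ∀ {e st'} →
    (∀ e' → Unsolved st e' → ¬ EagerApplicable st e') →
    Unsolved st e → NondetOK Γ₀ st e st' → Step Γ₀ st st'

AllSolved : State → Set
AllSolved st = ∀ e → e ∈ Γ st → e ∈ Sol st

data SuccessfulRun (Γ₀ : Problem) : State → Set₁ where
  done : ∀ {st} → AllSolved st → SuccessfulRun Γ₀ st
  step : ∀ {st st'} → Step Γ₀ st st' → SuccessfulRun Γ₀ st' → SuccessfulRun Γ₀ st

initState : Problem → State
initState Γ₀ = ⟨ Γ₀ , filter (λ e → T? (initSolved e)) Γ₀ , (λ _ → []) ⟩

SingleRHS : Problem → Set
SingleRHS Γ₀ = ∀ Cs Ds → dis Cs Ds ∈ Γ₀ → length Ds ≡ 1

-- Soundness: along a run, every element of Γ is built from atoms of Γ₀, S stays an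
-- acyclic assignment into At_nv, Γ stays closed under expansion, and every solved
-- element is initially solved or justified by the rule that solved it together with
-- the elements that rule added.  When everything is solved, acyclicity makes the
-- unfolding σ_S(X) = ⨅ σ_S(S_X) stabilise after |At| rounds, and a well-founded
-- induction on the size of the σ_S-instances shows that σ_S solves all of Γ ⊇ Γ₀.
--
-- Completeness: run the algorithm guided by a local solution σ = σ_{S₀}, keeping
-- that σ solves Γ and that σ(X) ⊑ σ(E) for all E ∈ S_X; the latter forces acyclicity,
-- as the role depth of σ decreases along >_S.  Under this invariant no eager rule
-- fails, and when none applies, structural subsumption (an atom below a conjunction
-- is below a conjunct) or σ(X) = ⨅ σ(S₀ X) tells which nondeterministic choice keeps
-- the invariant.  Each step solves a new element of a fixed finite set of candidates.

module Submission where

open import Defs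
open import Function.Bundles using (_⇔_; mk⇔)
open import Data.Nat as ℕ using (ℕ; zero; suc; _≤_; _<_; _⊔_; _+_; _*_; z≤n; s≤s)
open import Data.Nat.Induction using (<-wellFounded)
open import Induction.WellFounded using (Acc; acc)
import Data.Nat.Properties as ℕP
open import Data.Bool using (T; true; false; if_then_else_; not)
open import Data.Unit using (⊤; tt)
open import Data.Empty using (⊥-elim)
open import Data.Product using (Σ; _×_; _,_; proj₁; proj₂)
open import Data.Sum using (_⊎_; inj₁; inj₂)
open import Data.List as List using (List; []; _∷_; _++_; [_]; map; foldl; concatMap; length)
import Data.List.Properties as ListP
open import Data.List.Membership.Propositional using (_∈_; _∉_; lose; find)
open import Data.List.Membership.Propositional.Properties
open import Data.List.Relation.Unary.Any as Any using (here; there; any?)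
import Data.List.Relation.Unary.Any.Properties as AnyP
open import Data.List.Relation.Unary.All as All using (all?)
open import Data.Fin using (Fin)
import Data.Fin.Properties as FinP
open import Data.Vec using (Vec; []; _∷_; lookup)
import Data.Vec.Relation.Unary.Linked as Linked
open Linked using (Linked; [-]; _∷_)
import Data.Vec.Relation.Unary.Linked.Properties as LinkedP
import Data.List.Membership.DecPropositional as DecMembership
open import Relation.Nullary using (¬_; Dec; yes; no; does)
open import Relation.Nullary.Decidable using (T?; map′; ¬?; decidable-stable)
open import Relation.Binary.PropositionalEquality
  using (_≡_; _≢_; refl; cong; sym; trans; subst; subst₂)
import Relation.Binary.Construct.Closure.Transitive as TC
open TC using (TransClosure)

open DecMembership _≟E_ using () renaming (_∈?_ to _∈E?_)
open DecMembership _≟A_ using () renaming (_∈?_ to _∈A?_)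

-- Subsumption between EL concepts

data TopName (A : CName) : Concept → Set where
  here  : TopName A (nm A)
  left  : ∀ {C D} → TopName A C → TopName A (C ⊓ D)
  right : ∀ {C D} → TopName A D → TopName A (C ⊓ D)

data TopExists (r : RName) (y : Concept) : Concept → Set where
  here  : TopExists r y (∃c r y)
  left  : ∀ {C D} → TopExists r y C → TopExists r y (C ⊓ D)
  right : ∀ {C D} → TopExists r y D → TopExists r y (C ⊓ D)

-- Its elements are concepts; x is an instance of A, resp. an r-predecessor of y,
-- when A, resp. ∃r.y, is a top-level conjunct of x.
canonical : Interp
canonical = record
  { Δ = Concept ; cI = λ A x → TopName A x ; rI = λ r x y → TopExists r y x }

canonical-lift : ∀ C {x} → (∀ {A} → TopName A C → TopName A x) →
                 (∀ {r y} → TopExists r y C → TopExists r y x) → ⟦ C ⟧ canonical x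
canonical-lift ⊤c f g = tt
canonical-lift (nm A) f g = f here
canonical-lift (C ⊓ D) f g =
  canonical-lift C (λ t → f (left t)) (λ t → g (left t)) ,
  canonical-lift D (λ t → f (right t)) (λ t → g (right t))
canonical-lift (∃c r C) f g = C , g here , canonical-lift C (λ t → t) (λ t → t)

canonical-self : ∀ C → ⟦ C ⟧ canonical C
canonical-self C = canonical-lift C (λ t → t) (λ t → t)

TopName⇒⊑ : ∀ {A x} → TopName A x → x ⊑ nm A
TopName⇒⊑ here I d p = p
TopName⇒⊑ (left t) I d (p , _) = TopName⇒⊑ t I d p
TopName⇒⊑ (right t) I d (_ , q) = TopName⇒⊑ t I d q

TopExists⇒⊑ : ∀ {r y x} → TopExists r y x → x ⊑ ∃c r y
TopExists⇒⊑ here I d p = p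
TopExists⇒⊑ (left t) I d (p , _) = TopExists⇒⊑ t I d p
TopExists⇒⊑ (right t) I d (_ , q) = TopExists⇒⊑ t I d q

canonical⇒⊑ : ∀ D {x} → ⟦ D ⟧ canonical x → x ⊑ D
canonical⇒⊑ ⊤c _ I d _ = tt
canonical⇒⊑ (nm A) t = TopName⇒⊑ t
canonical⇒⊑ (D₁ ⊓ D₂) (a , b) I d p = canonical⇒⊑ D₁ a I d p , canonical⇒⊑ D₂ b I d p
canonical⇒⊑ (∃c r D) (y , e , t) I d p with TopExists⇒⊑ e I d p
... | z , rz , py = z , rz , canonical⇒⊑ D t I z py

⊑⇒canonical : ∀ {x D} → x ⊑ D → ⟦ D ⟧ canonical x
⊑⇒canonical {x} x⊑D = x⊑D canonical x (canonical-self x)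

⊑-refl : ∀ {C} → C ⊑ C
⊑-refl I d p = p

⊑-trans : ∀ {C D E} → C ⊑ D → D ⊑ E → C ⊑ E
⊑-trans f g I d p = g I d (f I d p)

∃c-mono-⊑ : ∀ {r C D} → C ⊑ D → ∃c r C ⊑ ∃c r D
∃c-mono-⊑ f I d (z , rz , p) = z , rz , f I z p

nm⋢∃c : ∀ {A r C} → ¬ (nm A ⊑ ∃c r C)
nm⋢∃c {A} {r} {C} h with ⊑⇒canonical {nm A} {∃c r C} h
... | _ , () , _

∃c⋢nm : ∀ {A r C} → ¬ (∃c r C ⊑ nm A)
∃c⋢nm {A} {r} {C} h with ⊑⇒canonical {∃c r C} {nm A} h
... | ()

nm⊑nm⇒≡ : ∀ {A B} → nm A ⊑ nm B → A ≡ B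
nm⊑nm⇒≡ {A} {B} h with ⊑⇒canonical {nm A} {nm B} h
... | here = refl

∃c⊑∃c⇒ : ∀ {r s C D} → ∃c r C ⊑ ∃c s D → r ≡ s × C ⊑ D
∃c⊑∃c⇒ {r} {s} {C} {D} h with ⊑⇒canonical {∃c r C} {∃c s D} h
... | _ , here , t = refl , canonical⇒⊑ D t

⨅-intro : ∀ {I x} Cs → (∀ C → C ∈ Cs → ⟦ C ⟧ I x) → ⟦ ⨅ Cs ⟧ I x
⨅-intro [] f = tt
⨅-intro (C ∷ []) f = f C (here refl)
⨅-intro (C ∷ Cs@(_ ∷ _)) f = f C (here refl) , ⨅-intro Cs (λ D m → f D (there m))

⨅-elim : ∀ {I x} Cs → ⟦ ⨅ Cs ⟧ I x → ∀ C → C ∈ Cs → ⟦ C ⟧ I x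
⨅-elim (C ∷ []) p .C (here refl) = p
⨅-elim (C ∷ Cs@(_ ∷ _)) (p , q) .C (here refl) = p
⨅-elim (C ∷ Cs@(_ ∷ _)) (p , q) D (there m) = ⨅-elim Cs q D m

⨅-lowerBound : ∀ {C} Cs → C ∈ Cs → ⨅ Cs ⊑ C
⨅-lowerBound Cs m I d p = ⨅-elim Cs p _ m

⨅-greatest : ∀ {E} Cs → (∀ C → C ∈ Cs → E ⊑ C) → E ⊑ ⨅ Cs
⨅-greatest Cs f I d p = ⨅-intro Cs (λ C m → f C m I d p)

data Atomic : Concept → Set where
  nm : ∀ A → Atomic (nm A)
  ∃c : ∀ r C → Atomic (∃c r C)

TopName-⨅ : ∀ {A} Cs → TopName A (⨅ Cs) → Σ Concept λ C → C ∈ Cs × TopName A C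
TopName-⨅ (C ∷ []) t = C , here refl , t
TopName-⨅ (C ∷ Cs@(_ ∷ _)) (left t) = C , here refl , t
TopName-⨅ (C ∷ Cs@(_ ∷ _)) (right t) with TopName-⨅ Cs t
... | D , m , t' = D , there m , t'

TopExists-⨅ : ∀ {r y} Cs → TopExists r y (⨅ Cs) → Σ Concept λ C → C ∈ Cs × TopExists r y C
TopExists-⨅ (C ∷ []) t = C , here refl , t
TopExists-⨅ (C ∷ Cs@(_ ∷ _)) (left t) = C , here refl , t
TopExists-⨅ (C ∷ Cs@(_ ∷ _)) (right t) with TopExists-⨅ Cs t
... | D , m , t' = D , there m , t'

⨅-⊑-Atomic : ∀ {D} Cs → Atomic D → ⨅ Cs ⊑ D → Σ Concept λ C → C ∈ Cs × C ⊑ D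
⨅-⊑-Atomic Cs (nm A) h with TopName-⨅ Cs (⊑⇒canonical {⨅ Cs} {nm A} h)
... | C , m , t = C , m , TopName⇒⊑ t
⨅-⊑-Atomic Cs (∃c r D) h with ⊑⇒canonical {⨅ Cs} {∃c r D} h
... | y , e , t with TopExists-⨅ Cs e
... | C , m , e' =
  C , m , ⊑-trans {C} {∃c r y} {∃c r D} (TopExists⇒⊑ e') (∃c-mono-⊑ {r} {y} {D} (canonical⇒⊑ D t))

TopName? : ∀ A x → Dec (TopName A x)
TopName? A ⊤c = no λ ()
TopName? A (nm B) with A ≟N B
... | yes refl = yes here
... | no A≢B = no λ { here → A≢B refl }
TopName? A (C ⊓ D) with TopName? A C | TopName? A D
... | yes p | _ = yes (left p)
... | no _ | yes q = yes (right q)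
... | no p | no q = no λ { (left a) → p a ; (right b) → q b }
TopName? A (∃c r C) = no λ ()

canonical-∃c? : ∀ r D → (∀ y → Dec (⟦ D ⟧ canonical y)) → ∀ x → Dec (⟦ ∃c r D ⟧ canonical x)
canonical-∃c? r D D? ⊤c = no λ { (_ , () , _) }
canonical-∃c? r D D? (nm A) = no λ { (_ , () , _) }
canonical-∃c? r D D? (C ⊓ C') with canonical-∃c? r D D? C | canonical-∃c? r D D? C'
... | yes (y , e , t) | _ = yes (y , left e , t)
... | no _ | yes (y , e , t) = yes (y , right e , t)
... | no p | no q = no λ { (y , left e , t) → p (y , e , t) ; (y , right e , t) → q (y , e , t) }
canonical-∃c? r D D? (∃c s C) with r ℕ.≟ s
... | no r≢s = no λ { (_ , here , _) → r≢s refl }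
... | yes refl with D? C
...   | yes t = yes (C , here , t)
...   | no p = no λ { (_ , here , t) → p t }

canonical? : ∀ D x → Dec (⟦ D ⟧ canonical x)
canonical? ⊤c x = yes tt
canonical? (nm A) x = TopName? A x
canonical? (D ⊓ D') x with canonical? D x | canonical? D' x
... | yes p | yes q = yes (p , q)
... | no p | _ = no λ { (a , b) → p a }
... | _ | no q = no λ { (a , b) → q b }
canonical? (∃c r D) x = canonical-∃c? r D (canonical? D) x

_⊑?_ : ∀ C D → Dec (C ⊑ D)
C ⊑? D = map′ (canonical⇒⊑ D) (⊑⇒canonical {C} {D}) (canonical? D C)

roleDepth : Concept → ℕ
roleDepth ⊤c = 0
roleDepth (nm _) = 0
roleDepth (C ⊓ D) = roleDepth C ⊔ roleDepth D
roleDepth (∃c r C) = suc (roleDepth C)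

roleDepth-TopExists : ∀ {r y x} → TopExists r y x → roleDepth y < roleDepth x
roleDepth-TopExists here = ℕP.≤-refl
roleDepth-TopExists {x = C ⊓ D} (left t) =
  ℕP.≤-trans (roleDepth-TopExists t) (ℕP.m≤m⊔n (roleDepth C) (roleDepth D))
roleDepth-TopExists {x = C ⊓ D} (right t) =
  ℕP.≤-trans (roleDepth-TopExists t) (ℕP.m≤n⊔m (roleDepth C) (roleDepth D))

roleDepth-canonical : ∀ D {x} → ⟦ D ⟧ canonical x → roleDepth D ≤ roleDepth x
roleDepth-canonical ⊤c t = z≤n
roleDepth-canonical (nm A) t = z≤n
roleDepth-canonical (D ⊓ D') (a , b) = ℕP.⊔-lub (roleDepth-canonical D a) (roleDepth-canonical D' b)
roleDepth-canonical (∃c r D) (y , e , t) = ℕP.≤-trans (s≤s (roleDepth-canonical D t)) (roleDepth-TopExists e)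

⊑⇒roleDepth-≥ : ∀ {x D} → x ⊑ D → roleDepth D ≤ roleDepth x
⊑⇒roleDepth-≥ {x} {D} h = roleDepth-canonical D (⊑⇒canonical {x} {D} h)

module _ (e : Elem) (st : State) where

  addE-Γ⁺ : ∀ {x} → x ∈ Γ st → x ∈ Γ (addE e st)
  addE-Γ⁺ m with e ∈E? Γ st
  ... | yes _ = m
  ... | no _ = ∈-++⁺ˡ m

  addE-self : e ∈ Γ (addE e st)
  addE-self with e ∈E? Γ st
  ... | yes p = p
  ... | no _ = ∈-++⁺ʳ (Γ st) (here refl)

  addE-Γ⁻ : ∀ {x} → x ∈ Γ (addE e st) → x ∈ Γ st ⊎ x ≡ e
  addE-Γ⁻ m with e ∈E? Γ st
  ... | yes _ = inj₁ m
  ... | no _ with ∈-++⁻ (Γ st) m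
  ...   | inj₁ p = inj₁ p
  ...   | inj₂ (here refl) = inj₂ refl

  addE-Sol⁺ : ∀ {x} → x ∈ Sol st → x ∈ Sol (addE e st)
  addE-Sol⁺ m with e ∈E? Γ st
  ... | yes _ = m
  ... | no _ with initSolved e
  ...   | true = ∈-++⁺ˡ m
  ...   | false = m

  addE-Sol⁻ : ∀ {x} → x ∈ Sol (addE e st) → x ∈ Sol st ⊎ (x ≡ e × T (initSolved e))
  addE-Sol⁻ m with e ∈E? Γ st
  ... | yes _ = inj₁ m
  ... | no _ with initSolved e
  ...   | true with ∈-++⁻ (Sol st) m
  ...     | inj₁ p = inj₁ p
  ...     | inj₂ (here refl) = inj₂ (refl , tt)
  addE-Sol⁻ m | no _ | false = inj₁ m

  addE-S : S (addE e st) ≡ S st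
  addE-S with e ∈E? Γ st
  ... | yes _ = refl
  ... | no _ = refl

  addE-initSolved : (∀ x → x ∈ Γ st → T (initSolved x) → x ∈ Sol st) →
                    ∀ x → x ∈ Γ (addE e st) → T (initSolved x) → x ∈ Sol (addE e st)
  addE-initSolved h x m t with e ∈E? Γ st
  ... | yes _ = h x m t
  ... | no _ with ∈-++⁻ (Γ st) m
  ...   | inj₁ p with initSolved e
  ...     | true = ∈-++⁺ˡ (h x p t)
  ...     | false = h x p t
  addE-initSolved h x m t | no _ | inj₂ (here refl) with initSolved x
  ...     | true = ∈-++⁺ʳ (Sol st) (here refl)

markSolved-self : ∀ e st → e ∈ Sol (markSolved e st)
markSolved-self e st = ∈-++⁺ʳ (Sol st) (here refl)

markSolved-Sol⁺ : ∀ e st {x} → x ∈ Sol st → x ∈ Sol (markSolved e st)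
markSolved-Sol⁺ e st m = ∈-++⁺ˡ m

markSolved-Sol⁻ : ∀ e st {x} → x ∈ Sol (markSolved e st) → x ∈ Sol st ⊎ x ≡ e
markSolved-Sol⁻ e st m with ∈-++⁻ (Sol st) m
... | inj₁ p = inj₁ p
... | inj₂ (here refl) = inj₂ refl

≡ᵇ-true⇒≡ : ∀ {m n} → (m ℕ.≡ᵇ n) ≡ true → m ≡ n
≡ᵇ-true⇒≡ {m} {n} eq = ℕP.≡ᵇ⇒≡ m n (subst T (sym eq) tt)

≡ᵇ-false⇒≢ : ∀ {m n} → (m ℕ.≡ᵇ n) ≡ false → m ≢ n
≡ᵇ-false⇒≢ {m} eq refl = subst T eq (ℕP.≡⇒≡ᵇ m m refl)

module _ (X : ℕ) (D : FAtom) (S₀ : Assignment) where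

  addS⁺ : ∀ {Y E} → E ∈ S₀ Y → E ∈ addS X D S₀ Y
  addS⁺ {Y} m with Y ℕ.≡ᵇ X | D ∈A? S₀ Y
  ... | true | no _ = ∈-++⁺ˡ m
  ... | true | yes _ = m
  ... | false | _ = m

  addS-self : D ∈ addS X D S₀ X
  addS-self with X ℕ.≡ᵇ X in eq | D ∈A? S₀ X
  ... | true | yes p = p
  ... | true | no _ = ∈-++⁺ʳ (S₀ X) (here refl)
  ... | false | _ = ⊥-elim (≡ᵇ-false⇒≢ {X} eq refl)

  addS⁻ : ∀ {Y E} → E ∈ addS X D S₀ Y → E ∈ S₀ Y ⊎ (Y ≡ X × E ≡ D)
  addS⁻ {Y} m with Y ℕ.≡ᵇ X in eq | D ∈A? S₀ Y
  ... | true | no _ with ∈-++⁻ (S₀ Y) m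
  ...   | inj₁ p = inj₁ p
  ...   | inj₂ (here refl) = inj₂ (≡ᵇ-true⇒≡ eq , refl)
  addS⁻ m | true | yes _ = inj₁ m
  addS⁻ m | false | _ = inj₁ m

  addS-other : ∀ {Y} → Y ≢ X → addS X D S₀ Y ≡ S₀ Y
  addS-other {Y} Y≢X with Y ℕ.≡ᵇ X in eq | D ∈A? S₀ Y
  ... | true | _ = ⊥-elim (Y≢X (≡ᵇ-true⇒≡ eq))
  ... | false | _ = refl

foldl-preserves : ∀ {ℓ} {A : Set} (g : A → State → State) (Q : State → Set ℓ) (cs : List A) →
                  (∀ st c → c ∈ cs → Q st → Q (g c st)) →
                  ∀ st → Q st → Q (foldl (λ s c → g c s) st cs)
foldl-preserves g Q [] h st q = q
foldl-preserves g Q (c ∷ cs) h st q =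
  foldl-preserves g Q cs (λ st' c' m → h st' c' (there m)) (g c st) (h st c (here refl) q)

addAll : List Elem → State → State
addAll es st = foldl (λ s e → addE e s) st es

addAll-preserves : ∀ {ℓ} (Q : State → Set ℓ) (es : List Elem) →
                   (∀ st e → e ∈ es → Q st → Q (addE e st)) → ∀ st → Q st → Q (addAll es st)
addAll-preserves = foldl-preserves addE

addAll-Γ⁺ : ∀ es st {x} → x ∈ es → x ∈ Γ (addAll es st)
addAll-Γ⁺ (e ∷ es) st (here refl) =
  addAll-preserves (λ s → e ∈ Γ s) es (λ st' e' _ p → addE-Γ⁺ e' st' p) (addE e st) (addE-self e st)
addAll-Γ⁺ (e ∷ es) st (there m) = addAll-Γ⁺ es (addE e st) m

addAll-Γ⁻ : ∀ es st {x} → x ∈ Γ (addAll es st) → x ∈ Γ st ⊎ x ∈ es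
addAll-Γ⁻ es st = addAll-preserves (λ s → ∀ {y} → y ∈ Γ s → y ∈ Γ st ⊎ y ∈ es) es addOne st inj₁
  where
  addOne : ∀ st' e → e ∈ es → (∀ {y} → y ∈ Γ st' → y ∈ Γ st ⊎ y ∈ es) →
         ∀ {y} → y ∈ Γ (addE e st') → y ∈ Γ st ⊎ y ∈ es
  addOne st' e e∈es h m with addE-Γ⁻ e st' m
  ... | inj₁ p = h p
  ... | inj₂ refl = inj₂ e∈es

addAll-S : ∀ es st → S (addAll es st) ≡ S st
addAll-S es st = addAll-preserves (λ s → S s ≡ S st) es (λ st' e _ p → trans (addE-S e st') p) st refl

data Expansion (X : ℕ) (SX : List FAtom) (Γ' : List Elem) : Elem → Set where
  viaSub : ∀ {Cs E} → sub Cs (at (var X)) ∈ Γ' → E ∈ SX → Expansion X SX Γ' (sub Cs E)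
  viaDis : ∀ {E D} → dis [ at (var X) ] [ D ] ∈ Γ' → T (not (isVarB D)) → E ∈ SX →
           Expansion X SX Γ' (dis [ E ] [ D ])

-- The local function of expandNew, which is not accessible from outside Defs.
expansionOf : ℕ → List FAtom → Elem → List Elem
expansionOf X SX (sub Cs (at (var Y))) = if does (Y ℕ.≟ X) then map (sub Cs) SX else []
expansionOf X SX (dis (at (var Y) ∷ []) (D ∷ [])) =
  if does (Y ℕ.≟ X) then (if isVarB D then [] else map (λ E → dis [ E ] [ D ]) SX) else []
expansionOf X SX _ = []

expandNew-∷ : ∀ X SX e es → expandNew X SX (e ∷ es) ≡ expansionOf X SX e ++ expandNew X SX es
expandNew-∷ X SX (sub Cs (at (var Y))) es = refl
expandNew-∷ X SX (sub Cs (at (con c))) es = refl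
expandNew-∷ X SX (sub Cs (ex r A)) es = refl
expandNew-∷ X SX (dis [] Ds) es = refl
expandNew-∷ X SX (dis (at (var Y) ∷ []) []) es = refl
expandNew-∷ X SX (dis (at (var Y) ∷ []) (D ∷ [])) es = refl
expandNew-∷ X SX (dis (at (var Y) ∷ []) (D ∷ D' ∷ Ds)) es = refl
expandNew-∷ X SX (dis (at (var Y) ∷ C ∷ Cs) Ds) es = refl
expandNew-∷ X SX (dis (at (con c) ∷ Cs) Ds) es = refl
expandNew-∷ X SX (dis (ex r A ∷ Cs) Ds) es = refl

Expansion-there : ∀ {X SX e es x} → Expansion X SX es x → Expansion X SX (e ∷ es) x
Expansion-there (viaSub m E∈) = viaSub (there m) E∈
Expansion-there (viaDis m t E∈) = viaDis (there m) t E∈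

expansionOf⁻ : ∀ X SX e es {x} → x ∈ expansionOf X SX e → Expansion X SX (e ∷ es) x
expansionOf⁻ X SX (sub Cs (at (var Y))) es m with Y ℕ.≡ᵇ X in eq
... | true with ∈-map⁻ (sub Cs) m
...   | E , E∈ , refl with ≡ᵇ-true⇒≡ {Y} {X} eq
...     | refl = viaSub (here refl) E∈
expansionOf⁻ X SX (dis (at (var Y) ∷ []) (D ∷ [])) es m with Y ℕ.≡ᵇ X in eq | isVarB D in eqD
... | true | false with ∈-map⁻ (λ E → dis [ E ] [ D ]) m
...   | E , E∈ , refl with ≡ᵇ-true⇒≡ {Y} {X} eq
...     | refl = viaDis (here refl) (subst (λ b → T (not b)) (sym eqD) tt) E∈
expansionOf⁻ X SX (dis (at (var Y) ∷ []) (D ∷ [])) es () | true | true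
expansionOf⁻ X SX (dis (at (var Y) ∷ []) (D ∷ [])) es () | false | _

expandNew⁻ : ∀ X SX Γ' {x} → x ∈ expandNew X SX Γ' → Expansion X SX Γ' x
expandNew⁻ X SX (e ∷ es) m rewrite expandNew-∷ X SX e es with ∈-++⁻ (expansionOf X SX e) m
... | inj₁ p = expansionOf⁻ X SX e es p
... | inj₂ p = Expansion-there (expandNew⁻ X SX es p)

expandNew⁺ : ∀ X SX Γ' {x} → Expansion X SX Γ' x → x ∈ expandNew X SX Γ'
expandNew⁺ X SX (e ∷ es) (viaSub {Cs} (here refl) E∈) rewrite expandNew-∷ X SX e es
  with X ℕ.≡ᵇ X in eq
... | false = ⊥-elim (≡ᵇ-false⇒≢ {X} eq refl)
... | true = ∈-++⁺ˡ (∈-map⁺ (sub Cs) E∈)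
expandNew⁺ X SX (e ∷ es) (viaDis {D = D} (here refl) t E∈) rewrite expandNew-∷ X SX e es
  with X ℕ.≡ᵇ X in eq | isVarB D
... | false | _ = ⊥-elim (≡ᵇ-false⇒≢ {X} eq refl)
... | true | false = ∈-++⁺ˡ (∈-map⁺ (λ E → dis [ E ] [ D ]) E∈)
expandNew⁺ X SX (e ∷ es) (viaSub (there m) E∈) rewrite expandNew-∷ X SX e es =
  ∈-++⁺ʳ (expansionOf X SX e) (expandNew⁺ X SX es (viaSub m E∈))
expandNew⁺ X SX (e ∷ es) (viaDis (there m) t E∈) rewrite expandNew-∷ X SX e es =
  ∈-++⁺ʳ (expansionOf X SX e) (expandNew⁺ X SX es (viaDis m t E∈))

expand-S : ∀ X st → S (expand X st) ≡ S st
expand-S X st = addAll-S (expandNew X (S st X) (Γ st)) st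

expand-Γ⁻ : ∀ X st {x} → x ∈ Γ (expand X st) → x ∈ Γ st ⊎ Expansion X (S st X) (Γ st) x
expand-Γ⁻ X st m with addAll-Γ⁻ (expandNew X (S st X) (Γ st)) st m
... | inj₁ p = inj₁ p
... | inj₂ p = inj₂ (expandNew⁻ X (S st X) (Γ st) p)

expand-Γ⁺ : ∀ X st {x} → Expansion X (S st X) (Γ st) x → x ∈ Γ (expand X st)
expand-Γ⁺ X st p = addAll-Γ⁺ (expandNew X (S st X) (Γ st)) st (expandNew⁺ X (S st X) (Γ st) p)

record _≼_ (a b : State) : Set where
  field
    Γ-mono   : ∀ {e} → e ∈ Γ a → e ∈ Γ b
    Sol-mono : ∀ {e} → e ∈ Sol a → e ∈ Sol b
    S-mono   : ∀ {X E} → E ∈ S a X → E ∈ S b X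
open _≼_ public

≼-refl : ∀ {a} → a ≼ a
≼-refl = record { Γ-mono = λ m → m ; Sol-mono = λ m → m ; S-mono = λ m → m }

≼-trans : ∀ {a b c} → a ≼ b → b ≼ c → a ≼ c
≼-trans p q = record
  { Γ-mono = λ m → Γ-mono q (Γ-mono p m)
  ; Sol-mono = λ m → Sol-mono q (Sol-mono p m)
  ; S-mono = λ m → S-mono q (S-mono p m) }

addE-≼ : ∀ e st → st ≼ addE e st
addE-≼ e st = record
  { Γ-mono = addE-Γ⁺ e st ; Sol-mono = addE-Sol⁺ e st
  ; S-mono = λ {X} m → subst (λ S' → _ ∈ S' X) (sym (addE-S e st)) m }

addS-≼ : ∀ X D st → st ≼ setS (addS X D (S st)) st
addS-≼ X D st = record { Γ-mono = λ m → m ; Sol-mono = λ m → m ; S-mono = addS⁺ X D (S st) }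

expand-≼ : ∀ X st → st ≼ expand X st
expand-≼ X st =
  addAll-preserves (st ≼_) (expandNew X (S st X) (Γ st)) (λ st' e _ p → ≼-trans p (addE-≼ e st')) st ≼-refl

module Preservation {ℓ ℓ'} (Q : State → Set ℓ) (P : Elem → Set ℓ')
                    (Q-addE : ∀ st e → P e → Q st → Q (addE e st))
                    (Q-expand : ∀ st X → Q st → Q (expand X st)) where

  expandIfVar-pres : ∀ C st → Q st → Q (expandIfVar C st)
  expandIfVar-pres (at (var X)) st q = Q-expand st X q
  expandIfVar-pres (at (con _)) st q = q
  expandIfVar-pres (ex _ _) st q = q

  expandIfVarL-pres : ∀ Cs st → Q st → Q (expandIfVarL Cs st)
  expandIfVarL-pres [] st q = q
  expandIfVarL-pres (at (var X) ∷ []) st q = Q-expand st X q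
  expandIfVarL-pres (at (con _) ∷ []) st q = q
  expandIfVarL-pres (ex _ _ ∷ []) st q = q
  expandIfVarL-pres (at (var _) ∷ _ ∷ _) st q = q
  expandIfVarL-pres (at (con _) ∷ _ ∷ _) st q = q
  expandIfVarL-pres (ex _ _ ∷ _ ∷ _) st q = q

  leftDec-pres : ∀ D Cs st → (∀ C → C ∈ Cs → P (dis [ C ] [ D ])) → Q st → Q (leftDec D Cs st)
  leftDec-pres D Cs st h q =
    foldl-preserves (λ C s → expandIfVar C (addE (dis [ C ] [ D ]) s)) Q Cs
      (λ st' C m q' → expandIfVar-pres C _ (Q-addE st' _ (h C m) q')) st q

  expandDec-pres : ∀ C' D' st → Q st → Q (expandDec C' D' st)
  expandDec-pres (var X) (var Y) st q = q
  expandDec-pres (var X) (con c) st q = Q-expand st X q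
  expandDec-pres (con c) D' st q = q

module ≼-Preservation (st₀ : State) = Preservation (st₀ ≼_) (λ _ → ⊤)
  (λ st e _ p → ≼-trans p (addE-≼ e st)) (λ st X p → ≼-trans p (expand-≼ X st))

lhs : Elem → List FAtom
lhs (sub Cs _) = Cs
lhs (dis Cs _) = Cs

module WellFormed (Γ₀ : Problem) where

  -- Left-hand sides produced by the rules: those of Γ₀ and single atoms of Γ₀.
  AdmissibleLhs : List FAtom → Set
  AdmissibleLhs Cs = (Σ Elem λ e → e ∈ Γ₀ × lhs e ≡ Cs) ⊎ (Σ FAtom λ C → Cs ≡ [ C ] × InAt Γ₀ C)

  WF : Elem → Set
  WF (sub Cs D) = AdmissibleLhs Cs × InAt Γ₀ D
  WF (dis Cs Ds) = AdmissibleLhs Cs × Σ FAtom λ D → Ds ≡ [ D ] × InAt Γ₀ D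

  AdmissibleLhs-InAt : ∀ {Cs a} → AdmissibleLhs Cs → a ∈ Cs → InAt Γ₀ a
  AdmissibleLhs-InAt (inj₁ (sub Cs D , m , refl)) a∈ = sub Cs D , m , _ , subL a∈ , self
  AdmissibleLhs-InAt (inj₁ (dis Cs Ds , m , refl)) a∈ = dis Cs Ds , m , _ , disL a∈ , self
  AdmissibleLhs-InAt (inj₂ (C , refl , p)) (here refl) = p

  InAt-∃ : ∀ {r A} → InAt Γ₀ (ex r A) → InAt Γ₀ (at A)
  InAt-∃ (e , m , b , ab , self) = e , m , b , ab , inEx

  AdmissibleLhs-single : ∀ {C} → InAt Γ₀ C → AdmissibleLhs [ C ]
  AdmissibleLhs-single p = inj₂ (_ , refl , p)

  record Invariant (st : State) : Set where
    field
      Γ₀⊆Γ          : ∀ e → e ∈ Γ₀ → e ∈ Γ st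
      wellFormed    : ∀ {e} → e ∈ Γ st → WF e
      initSolved∈Sol : ∀ e → e ∈ Γ st → T (initSolved e) → e ∈ Sol st
      assigned-InAtNv : ∀ {X E} → E ∈ S st X → InAtNv Γ₀ E
      assigned-InVar : ∀ {X E} → E ∈ S st X → InVar Γ₀ X
      acyclic       : Acyclic (S st)
  open Invariant public

  addE-Invariant : ∀ st e → WF e → Invariant st → Invariant (addE e st)
  addE-Invariant st e w I = record
    { Γ₀⊆Γ = λ x m → addE-Γ⁺ e st (Γ₀⊆Γ I x m)
    ; wellFormed = λ m → wf (addE-Γ⁻ e st m)
    ; initSolved∈Sol = addE-initSolved e st (initSolved∈Sol I)
    ; assigned-InAtNv = λ m → assigned-InAtNv I (S-same m)
    ; assigned-InVar = λ m → assigned-InVar I (S-same m)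
    ; acyclic = subst Acyclic (sym (addE-S e st)) (acyclic I) }
    where
    wf : ∀ {x} → x ∈ Γ st ⊎ x ≡ e → WF x
    wf (inj₁ p) = wellFormed I p
    wf (inj₂ refl) = w
    S-same : ∀ {X E} → E ∈ S (addE e st) X → E ∈ S st X
    S-same {X} m = subst (λ S' → _ ∈ S' X) (addE-S e st) m

  markSolved-Invariant : ∀ st e → Invariant st → Invariant (markSolved e st)
  markSolved-Invariant st e I = record
    { Γ₀⊆Γ = Γ₀⊆Γ I
    ; wellFormed = wellFormed I
    ; initSolved∈Sol = λ x m t → markSolved-Sol⁺ e st (initSolved∈Sol I x m t)
    ; assigned-InAtNv = assigned-InAtNv I ; assigned-InVar = assigned-InVar I ; acyclic = acyclic I }

  addS-Invariant : ∀ st X D → InAtNv Γ₀ D → InVar Γ₀ X → Acyclic (addS X D (S st)) →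
                   Invariant st → Invariant (setS (addS X D (S st)) st)
  addS-Invariant st X D pD pX ac I = record
    { Γ₀⊆Γ = Γ₀⊆Γ I
    ; wellFormed = wellFormed I ; initSolved∈Sol = initSolved∈Sol I
    ; assigned-InAtNv = λ {Y} m → atNv {Y} m ; assigned-InVar = λ {Y} m → inVar {Y} m ; acyclic = ac }
    where
    atNv : ∀ {Y E} → E ∈ addS X D (S st) Y → InAtNv Γ₀ E
    atNv {Y} m with addS⁻ X D (S st) {Y} m
    ... | inj₁ p = assigned-InAtNv I p
    ... | inj₂ (_ , refl) = pD
    inVar : ∀ {Y E} → E ∈ addS X D (S st) Y → InVar Γ₀ Y
    inVar {Y} m with addS⁻ X D (S st) {Y} m
    ... | inj₁ p = assigned-InVar I p
    ... | inj₂ (refl , _) = pX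

  Expansion-WF : ∀ st X {x} → Invariant st → Expansion X (S st X) (Γ st) x → WF x
  Expansion-WF st X I (viaSub m E∈) = proj₁ (wellFormed I m) , proj₁ (assigned-InAtNv I E∈)
  Expansion-WF st X I (viaDis m t E∈) with wellFormed I m
  ... | _ , D , refl , pD = AdmissibleLhs-single (proj₁ (assigned-InAtNv I E∈)) , D , refl , pD

  expand-Invariant : ∀ st X → Invariant st → Invariant (expand X st)
  expand-Invariant st X I = addAll-preserves Invariant (expandNew X (S st X) (Γ st))
    (λ st' e m I' → addE-Invariant st' e (Expansion-WF st X I (expandNew⁻ X (S st X) (Γ st) m)) I') st I

  module Invariant-Preservation =
    Preservation Invariant WF addE-Invariant expand-Invariant

  unsolved-¬initSolved : ∀ {st e} → Invariant st → Unsolved st e → ¬ T (initSolved e)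
  unsolved-¬initSolved {e = e} I (e∈ , e∉) t = e∉ (initSolved∈Sol I e e∈ t)

  unsolved-sub-NonVar : ∀ {st Cs D} → Invariant st → Unsolved st (sub Cs D) → NonVar D
  unsolved-sub-NonVar I u (isVar Y) = unsolved-¬initSolved I u tt

-- Why a solved element holds: the rule that solved it, together with the
-- elements of G that this rule added.
data Justified (G : List Elem) (Sa : Assignment) : Elem → Set₁ where
  byGroundSolving : ∀ {e} → GroundElem e → HoldsGround e → Justified G Sa e
  bySolving : ∀ {Cs D} → SolvCond Sa Cs D → Justified G Sa (sub Cs D)
  byDecomposition : ∀ {Cs s C D} → ex s C ∈ Cs → sub [ at C ] (at D) ∈ G →
                    Justified G Sa (sub Cs (ex s D))
  byLeftDecomposition : ∀ {Cs D} → NonVar D → length Cs ≢ 1 →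
                        (∀ C → C ∈ Cs → dis [ C ] [ D ] ∈ G) → Justified G Sa (dis Cs [ D ])
  byGroundAtoms : ∀ {C D} → GroundAtom C → GroundAtom D → ¬ (atomC C ⊑ atomC D) →
                  Justified G Sa (dis [ C ] [ D ])
  byConstant⋢∃ : ∀ {c r A} → Justified G Sa (dis [ at (con c) ] [ ex r A ])
  by∃⋢Constant : ∀ {c r A} → Justified G Sa (dis [ ex r A ] [ at (con c) ])
  byRoleClash : ∀ {r s C' D'} → r ≢ s → Justified G Sa (dis [ ex r C' ] [ ex s D' ])
  byAtomicDecomposition : ∀ {r C' D'} → dis [ at C' ] [ at D' ] ∈ G →
                          Justified G Sa (dis [ ex r C' ] [ ex r D' ])
  byLocalExtension : ∀ {Cs X D} → D ∈ Sa X → dis Cs [ D ] ∈ G →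
                     Justified G Sa (dis Cs [ at (var X) ])

Justified-mono : ∀ {a b e} → a ≼ b → Justified (Γ a) (S a) e → Justified (Γ b) (S b) e
Justified-mono p (byGroundSolving g h) = byGroundSolving g h
Justified-mono p (bySolving (C , m , inj₁ eq)) = bySolving (C , m , inj₁ eq)
Justified-mono p (bySolving (C , m , inj₂ (X , eq , D∈))) = bySolving (C , m , inj₂ (X , eq , S-mono p D∈))
Justified-mono p (byDecomposition m g) = byDecomposition m (Γ-mono p g)
Justified-mono p (byLeftDecomposition nv l h) = byLeftDecomposition nv l (λ C m → Γ-mono p (h C m))
Justified-mono p (byGroundAtoms g g' n) = byGroundAtoms g g' n
Justified-mono p byConstant⋢∃ = byConstant⋢∃
Justified-mono p by∃⋢Constant = by∃⋢Constant
Justified-mono p (byRoleClash r≢s) = byRoleClash r≢s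
Justified-mono p (byAtomicDecomposition m) = byAtomicDecomposition (Γ-mono p m)
Justified-mono p (byLocalExtension D∈ g) = byLocalExtension (S-mono p D∈) (Γ-mono p g)

SolvedJustified : State → Set₁
SolvedJustified st = ∀ e → e ∈ Sol st → T (initSolved e) ⊎ Justified (Γ st) (S st) e

SolvedJustified-≼ : ∀ {a b} → a ≼ b → (∀ {e} → e ∈ Sol b → e ∈ Sol a ⊎ T (initSolved e)) →
                    SolvedJustified a → SolvedJustified b
SolvedJustified-≼ p h J e m with h m
... | inj₂ t = inj₁ t
... | inj₁ m' with J e m'
...   | inj₁ t = inj₁ t
...   | inj₂ r = inj₂ (Justified-mono p r)

addE-SolvedJustified : ∀ st e → SolvedJustified st → SolvedJustified (addE e st)
addE-SolvedJustified st e = SolvedJustified-≼ (addE-≼ e st) new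
  where
  new : ∀ {x} → x ∈ Sol (addE e st) → x ∈ Sol st ⊎ T (initSolved x)
  new m with addE-Sol⁻ e st m
  ... | inj₁ p = inj₁ p
  ... | inj₂ (refl , t) = inj₂ t

expand-SolvedJustified : ∀ st X → SolvedJustified st → SolvedJustified (expand X st)
expand-SolvedJustified st X =
  addAll-preserves SolvedJustified (expandNew X (S st X) (Γ st)) (λ st' e _ → addE-SolvedJustified st' e) st

addS-SolvedJustified : ∀ st X D → SolvedJustified st → SolvedJustified (setS (addS X D (S st)) st)
addS-SolvedJustified st X D = SolvedJustified-≼ (addS-≼ X D st) inj₁

markSolved-SolvedJustified : ∀ st e → SolvedJustified st → Justified (Γ st) (S st) e →
                             SolvedJustified (markSolved e st)
markSolved-SolvedJustified st e J r x m with markSolved-Sol⁻ e st m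
... | inj₁ p = J x p
... | inj₂ refl = inj₂ r

module SolvedJustified-Preservation =
  Preservation SolvedJustified (λ _ → ⊤) (λ st e _ → addE-SolvedJustified st e) expand-SolvedJustified

data Triggers : Elem → ℕ → Set where
  subTrigger : ∀ {Cs X} → Triggers (sub Cs (at (var X))) X
  disTrigger : ∀ {X D} → T (not (isVarB D)) → Triggers (dis [ at (var X) ] [ D ]) X

Triggers-unique : ∀ {e Y Z} → Triggers e Y → Triggers e Z → Y ≡ Z
Triggers-unique subTrigger subTrigger = refl
Triggers-unique (disTrigger _) (disTrigger _) = refl

Expansion-along : ∀ {X SX SX' Γ₁ Γ₂ x} → (∀ {E} → E ∈ SX' → E ∈ SX) →
                  (∀ {t} → Triggers t X → t ∈ Γ₂ → t ∈ Γ₁) →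
                  Expansion X SX' Γ₂ x → Expansion X SX Γ₁ x
Expansion-along f g (viaSub m E∈) = viaSub (g subTrigger m) (f E∈)
Expansion-along f g (viaDis m t E∈) = viaDis (g (disTrigger t) m) t (f E∈)

ExpandedAt : State → ℕ → Set
ExpandedAt st X = ∀ {x} → Expansion X (S st X) (Γ st) x → x ∈ Γ st

Expanded : State → Set
Expanded st = ∀ X → ExpandedAt st X

NonVar⇒¬isVarB : ∀ {D} → NonVar D → T (not (isVarB D))
NonVar⇒¬isVarB {at (var Y)} nv = ⊥-elim (nv (isVar Y))
NonVar⇒¬isVarB {at (con c)} nv = tt
NonVar⇒¬isVarB {ex r A} nv = tt

addE-ExpandedAt : ∀ st e Y → ¬ Triggers e Y → ExpandedAt st Y → ExpandedAt (addE e st) Y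
addE-ExpandedAt st e Y ¬t c p =
  addE-Γ⁺ e st (c (Expansion-along (λ m → subst (λ S' → _ ∈ S' Y) (addE-S e st) m) old p))
  where
  old : ∀ {t} → Triggers t Y → t ∈ Γ (addE e st) → t ∈ Γ st
  old t m with addE-Γ⁻ e st m
  ... | inj₁ p = p
  ... | inj₂ refl = ⊥-elim (¬t t)

addS-ExpandedAt : ∀ st X D Y → Y ≢ X → ExpandedAt st Y → ExpandedAt (setS (addS X D (S st)) st) Y
addS-ExpandedAt st X D Y Y≢X c rewrite addS-other X D (S st) Y≢X = c

module Expansion-Closure (Γ₀ : Problem) where
  open WellFormed Γ₀

  -- The new elements carry a non-variable atom of S_X where a trigger has a variable.
  Expansion-¬Triggers : ∀ {st X x Y} → Invariant st → Expansion X (S st X) (Γ st) x → ¬ Triggers x Y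
  Expansion-¬Triggers I (viaSub m E∈) subTrigger = proj₂ (assigned-InAtNv I E∈) (isVar _)
  Expansion-¬Triggers I (viaDis m t E∈) (disTrigger _) = proj₂ (assigned-InAtNv I E∈) (isVar _)

  expand-Triggers⁻ : ∀ st X {t Y} → Invariant st → Triggers t Y → t ∈ Γ (expand X st) → t ∈ Γ st
  expand-Triggers⁻ st X I t m with expand-Γ⁻ X st m
  ... | inj₁ p = p
  ... | inj₂ q = ⊥-elim (Expansion-¬Triggers I q t)

  expand-ExpandedAt-other : ∀ st X Y → Invariant st → ExpandedAt st Y → ExpandedAt (expand X st) Y
  expand-ExpandedAt-other st X Y I c p =
    Γ-mono (expand-≼ X st)
      (c (Expansion-along (λ m → subst (λ S' → _ ∈ S' Y) (expand-S X st) m) (expand-Triggers⁻ st X I) p))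

  expand-ExpandedAt-self : ∀ st X → Invariant st → ExpandedAt (expand X st) X
  expand-ExpandedAt-self st X I p =
    expand-Γ⁺ X st
      (Expansion-along (λ m → subst (λ S' → _ ∈ S' X) (expand-S X st) m) (expand-Triggers⁻ st X I) p)

  expand-ExpandedAt : ∀ st X Z → Invariant st → (Z ≢ X → ExpandedAt st Z) → ExpandedAt (expand X st) Z
  expand-ExpandedAt st X Z I h with Z ℕ.≟ X
  ... | yes refl = expand-ExpandedAt-self st X I
  ... | no Z≢X = expand-ExpandedAt-other st X Z I (h Z≢X)

  addE-Expanded : ∀ st e → (∀ Y → ¬ Triggers e Y) → Expanded st → Expanded (addE e st)
  addE-Expanded st e ¬t c Y = addE-ExpandedAt st e Y (¬t Y) (c Y)

  addE-expand-Expanded : ∀ st e Y → Invariant st → WF e → Triggers e Y → Expanded st →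
                         Expanded (expand Y (addE e st))
  addE-expand-Expanded st e Y I w t c Z =
    expand-ExpandedAt (addE e st) Y Z (addE-Invariant st e w I)
      (λ Z≢Y → addE-ExpandedAt st e Z (λ t' → Z≢Y (sym (Triggers-unique t t'))) (c Z))

module Soundness (Γ₀ : Problem) where
  open WellFormed Γ₀
  open Expansion-Closure Γ₀

  RunInvariant : State → Set₁
  RunInvariant st = Invariant st × SolvedJustified st × Expanded st

  addE-RunInvariant : ∀ st e → WF e → (∀ Y → ¬ Triggers e Y) → RunInvariant st → RunInvariant (addE e st)
  addE-RunInvariant st e w ¬t (I , J , C) =
    addE-Invariant st e w I , addE-SolvedJustified st e J , addE-Expanded st e ¬t C

  addE-expand-RunInvariant : ∀ st e Y → WF e → Triggers e Y → RunInvariant st →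
                             RunInvariant (expand Y (addE e st))
  addE-expand-RunInvariant st e Y w t (I , J , C) =
    expand-Invariant _ Y (addE-Invariant st e w I) ,
    expand-SolvedJustified _ Y (addE-SolvedJustified st e J) ,
    addE-expand-Expanded st e Y I w t C

  markSolved-RunInvariant : ∀ st e → RunInvariant st → Justified (Γ st) (S st) e →
                            RunInvariant (markSolved e st)
  markSolved-RunInvariant st e (I , J , C) r =
    markSolved-Invariant st e I , markSolved-SolvedJustified st e J r , C

  extension-RunInvariant : ∀ st Cs D X → RunInvariant st → Unsolved st (sub Cs D) → at (var X) ∈ Cs →
                           Acyclic (addS X D (S st)) →
                           RunInvariant (markSolved (sub Cs D) (expand X (setS (addS X D (S st)) st)))
  extension-RunInvariant st Cs D X (I , J , C) u X∈ ac =
    markSolved-RunInvariant st₂ (sub Cs D) (I₂ , J₂ , C₂)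
      (bySolving (at (var X) , X∈ , inj₂ (X , refl , S-mono (expand-≼ X st₁) (addS-self X D (S st)))))
    where
    w : WF (sub Cs D)
    w = wellFormed I (proj₁ u)
    st₁ st₂ : State
    st₁ = setS (addS X D (S st)) st
    st₂ = expand X st₁
    I₁ : Invariant st₁
    I₁ = addS-Invariant st X D (proj₂ w , unsolved-sub-NonVar I u) (AdmissibleLhs-InAt (proj₁ w) X∈) ac I
    I₂ : Invariant st₂
    I₂ = expand-Invariant st₁ X I₁
    J₂ : SolvedJustified st₂
    J₂ = expand-SolvedJustified st₁ X (addS-SolvedJustified st X D J)
    C₂ : Expanded st₂
    C₂ Z = expand-ExpandedAt st₁ X Z I₁ (λ Z≢X → addS-ExpandedAt st X D Z Z≢X (C Z))

  leftDecStep-RunInvariant : ∀ D C st → NonVar D → WF (dis [ C ] [ D ]) → RunInvariant st →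
                             RunInvariant (expandIfVar C (addE (dis [ C ] [ D ]) st))
  leftDecStep-RunInvariant D (at (var Y)) st nv w q =
    addE-expand-RunInvariant st _ Y w (disTrigger (NonVar⇒¬isVarB nv)) q
  leftDecStep-RunInvariant D (at (con c)) st nv w q = addE-RunInvariant st _ w (λ { Y () }) q
  leftDecStep-RunInvariant D (ex r A) st nv w q = addE-RunInvariant st _ w (λ { Y () }) q

  leftDec-RunInvariant : ∀ D Cs st → NonVar D → (∀ C → C ∈ Cs → WF (dis [ C ] [ D ])) →
                         RunInvariant st → RunInvariant (leftDec D Cs st)
  leftDec-RunInvariant D Cs st nv h =
    foldl-preserves (λ C s → expandIfVar C (addE (dis [ C ] [ D ]) s)) RunInvariant Cs
      (λ s C m → leftDecStep-RunInvariant D C s nv (h C m)) st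

  leftDec-Γ⁺ : ∀ D Cs st {C} → C ∈ Cs → dis [ C ] [ D ] ∈ Γ (leftDec D Cs st)
  leftDec-Γ⁺ D (C ∷ Cs) st (here refl) =
    Γ-mono (≼-Preservation.leftDec-pres s₁ D Cs s₁ (λ _ _ → tt) ≼-refl)
      (Γ-mono (≼-Preservation.expandIfVar-pres (addE (dis [ C ] [ D ]) st) C _ ≼-refl) (addE-self _ st))
    where
    s₁ : State
    s₁ = expandIfVar C (addE (dis [ C ] [ D ]) st)
  leftDec-Γ⁺ D (C ∷ Cs) st (there m) = leftDec-Γ⁺ D Cs _ m

  addAtomicDec-RunInvariant : ∀ C' D' st → RunInvariant st → WF (dis [ at C' ] [ at D' ]) →
                           RunInvariant (expandDec C' D' (addE (dis [ at C' ] [ at D' ]) st))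
  addAtomicDec-RunInvariant (var X) (var Y) st q w = addE-RunInvariant st _ w (λ { Z (disTrigger ()) }) q
  addAtomicDec-RunInvariant (var X) (con d) st q w = addE-expand-RunInvariant st _ X w (disTrigger tt) q
  addAtomicDec-RunInvariant (con c) D' st q w = addE-RunInvariant st _ w (λ { Z () }) q

  addDecomposed-RunInvariant : ∀ C' D st → RunInvariant st → WF (sub [ at C' ] (at D)) →
                               RunInvariant (expandIfVar (at D) (addE (sub [ at C' ] (at D)) st))
  addDecomposed-RunInvariant C' (var X) st q w = addE-expand-RunInvariant st _ X w subTrigger q
  addDecomposed-RunInvariant C' (con c) st q w = addE-RunInvariant st _ w (λ { Z () }) q

  leftDecomposition-RunInvariant : ∀ st Cs D → RunInvariant st → Unsolved st (dis Cs [ D ]) →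
                                   length Cs ≢ 1 → NonVar D →
                                   RunInvariant (markSolved (dis Cs [ D ]) (leftDec D Cs st))
  leftDecomposition-RunInvariant st Cs D q@(I , _) u len nv with wellFormed I (proj₁ u)
  ... | lo , _ , refl , pD =
    markSolved-RunInvariant _ _
      (leftDec-RunInvariant D Cs st nv (λ C m → AdmissibleLhs-single (AdmissibleLhs-InAt lo m) , D , refl , pD) q)
      (byLeftDecomposition nv len (λ C m → leftDec-Γ⁺ D Cs st m))

  atomicDecomposition-RunInvariant : ∀ st r C' D' → RunInvariant st →
    Unsolved st (dis [ ex r C' ] [ ex r D' ]) →
    RunInvariant (markSolved (dis [ ex r C' ] [ ex r D' ])
                   (expandDec C' D' (addE (dis [ at C' ] [ at D' ]) st)))
  atomicDecomposition-RunInvariant st r C' D' q@(I , _) u with wellFormed I (proj₁ u)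
  ... | lo , _ , refl , pD =
    markSolved-RunInvariant _ _ (addAtomicDec-RunInvariant C' D' st q w)
      (byAtomicDecomposition (Γ-mono (≼-Preservation.expandDec-pres st₁ C' D' st₁ ≼-refl) (addE-self _ st)))
    where
    w : WF (dis [ at C' ] [ at D' ])
    w = AdmissibleLhs-single (InAt-∃ (AdmissibleLhs-InAt lo (here refl))) , at D' , refl , InAt-∃ pD
    st₁ : State
    st₁ = addE (dis [ at C' ] [ at D' ]) st

  decomposition-RunInvariant : ∀ st Cs s C' D → RunInvariant st → Unsolved st (sub Cs (ex s D)) →
    ex s C' ∈ Cs →
    RunInvariant (markSolved (sub Cs (ex s D)) (expandIfVar (at D) (addE (sub [ at C' ] (at D)) st)))
  decomposition-RunInvariant st Cs s C' D q@(I , _) u m with wellFormed I (proj₁ u)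
  ... | lo , pD =
    markSolved-RunInvariant _ _ (addDecomposed-RunInvariant C' D st q w)
      (byDecomposition m (Γ-mono (≼-Preservation.expandIfVar-pres st₁ (at D) st₁ ≼-refl) (addE-self _ st)))
    where
    w : WF (sub [ at C' ] (at D))
    w = AdmissibleLhs-single (InAt-∃ (AdmissibleLhs-InAt lo m)) , InAt-∃ pD
    st₁ : State
    st₁ = addE (sub [ at C' ] (at D)) st

  singleVar-or-inert : ∀ Cs D → (Σ ℕ λ Y → Cs ≡ [ at (var Y) ]) ⊎
                       ((∀ Z → ¬ Triggers (dis Cs [ D ]) Z) × (∀ st → expandIfVarL Cs st ≡ st))
  singleVar-or-inert (at (var Y) ∷ []) D = inj₁ (Y , refl)
  singleVar-or-inert [] D = inj₂ ((λ { Z () }) , λ st → refl)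
  singleVar-or-inert (at (con c) ∷ []) D = inj₂ ((λ { Z () }) , λ st → refl)
  singleVar-or-inert (ex r A ∷ []) D = inj₂ ((λ { Z () }) , λ st → refl)
  singleVar-or-inert (at (var Y) ∷ _ ∷ _) D = inj₂ ((λ { Z () }) , λ st → refl)
  singleVar-or-inert (at (con c) ∷ _ ∷ _) D = inj₂ ((λ { Z () }) , λ st → refl)
  singleVar-or-inert (ex r A ∷ _ ∷ _) D = inj₂ ((λ { Z () }) , λ st → refl)

  localExtension-RunInvariant : ∀ st Cs X D → RunInvariant st → Unsolved st (dis Cs [ at (var X) ]) →
    InAtNv Γ₀ D → Acyclic (addS X D (S st)) →
    RunInvariant (markSolved (dis Cs [ at (var X) ])
      (expandIfVarL Cs (expand X (addE (dis Cs [ D ]) (setS (addS X D (S st)) st)))))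
  localExtension-RunInvariant st Cs X D (I , J , C) u pD ac with wellFormed I (proj₁ u)
  ... | lo , _ , refl , pX =
    markSolved-RunInvariant st₄ _ (I₄ , J₄ , C₄)
      (byLocalExtension (S-mono (≼-trans (addE-≼ _ st₁) st₂≼st₄) (addS-self X D (S st)))
                        (Γ-mono st₂≼st₄ (addE-self _ st₁)))
    where
    st₁ st₂ st₃ st₄ : State
    st₁ = setS (addS X D (S st)) st
    st₂ = addE (dis Cs [ D ]) st₁
    st₃ = expand X st₂
    st₄ = expandIfVarL Cs st₃
    I₁ : Invariant st₁
    I₁ = addS-Invariant st X D pD pX ac I
    I₂ : Invariant st₂
    I₂ = addE-Invariant st₁ _ (lo , D , refl , proj₁ pD) I₁
    I₃ : Invariant st₃
    I₃ = expand-Invariant st₂ X I₂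
    I₄ : Invariant st₄
    I₄ = Invariant-Preservation.expandIfVarL-pres Cs st₃ I₃
    J₄ : SolvedJustified st₄
    J₄ = SolvedJustified-Preservation.expandIfVarL-pres Cs st₃
           (expand-SolvedJustified st₂ X (addE-SolvedJustified st₁ _ (addS-SolvedJustified st X D J)))
    st₂≼st₄ : st₂ ≼ st₄
    st₂≼st₄ = ≼-trans (expand-≼ X st₂) (≼-Preservation.expandIfVarL-pres st₃ Cs st₃ ≼-refl)
    C₃ : ∀ Z → ¬ Triggers (dis Cs [ D ]) Z → ExpandedAt st₃ Z
    C₃ Z ¬t = expand-ExpandedAt st₂ X Z I₂
                (λ Z≢X → addE-ExpandedAt st₁ _ Z ¬t (addS-ExpandedAt st X D Z Z≢X (C Z)))
    C₄ : Expanded st₄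
    C₄ with singleVar-or-inert Cs D
    ... | inj₁ (Y , refl) =
      λ Z → expand-ExpandedAt st₃ Y Z I₃ (λ Z≢Y → C₃ Z (λ { (disTrigger _) → Z≢Y refl }))
    ... | inj₂ (¬t , inert) rewrite inert st₃ = λ Z → C₃ Z (¬t Z)

  atomicDecC-Justified : ∀ {G Sa C D} → NonVar C → NonVar D → ¬ (GroundAtom C × GroundAtom D) →
                         (Σ ℕ λ c → C ≡ at (con c)) ⊎ (Σ ℕ λ c → D ≡ at (con c)) →
                         Justified G Sa (dis [ C ] [ D ])
  atomicDecC-Justified {C = at (var x)} nvC _ _ _ = ⊥-elim (nvC (isVar x))
  atomicDecC-Justified {D = at (var y)} _ nvD _ _ = ⊥-elim (nvD (isVar y))
  atomicDecC-Justified {C = at (con c)} {at (con d)} _ _ ¬g _ = ⊥-elim (¬g (gAt c , gAt d))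
  atomicDecC-Justified {C = at (con c)} {ex r A} _ _ _ _ = byConstant⋢∃
  atomicDecC-Justified {C = ex r A} {at (con c)} _ _ _ _ = by∃⋢Constant
  atomicDecC-Justified {C = ex r A} {ex s B} _ _ _ (inj₁ (_ , ()))
  atomicDecC-Justified {C = ex r A} {ex s B} _ _ _ (inj₂ (_ , ()))

  eager-RunInvariant : ∀ {st e st'} → RunInvariant st → Unsolved st e → EagerOK Γ₀ st e st' →
                       RunInvariant st'
  eager-RunInvariant q u (groundSolving g h) = markSolved-RunInvariant _ _ q (byGroundSolving g h)
  eager-RunInvariant q u (solving _ sc) = markSolved-RunInvariant _ _ q (bySolving sc)
  eager-RunInvariant q u (extension {Cs} {D} {X} _ _ (X∈ , _) ac) = extension-RunInvariant _ Cs D X q u X∈ ac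
  eager-RunInvariant q u (leftDecomposition {Cs} {D} _ _ len nv) = leftDecomposition-RunInvariant _ Cs D q u len nv
  eager-RunInvariant q u (atomicDecB _ _ _ _ gC gD ⋢) = markSolved-RunInvariant _ _ q (byGroundAtoms gC gD ⋢)
  eager-RunInvariant q u (atomicDecC _ _ nvC nvD ¬g isCon) =
    markSolved-RunInvariant _ _ q (atomicDecC-Justified nvC nvD ¬g isCon)
  eager-RunInvariant q u (atomicDecD _ _ _ r≢s) = markSolved-RunInvariant _ _ q (byRoleClash r≢s)
  eager-RunInvariant q u (atomicDecE {r} {C'} {D'} _ _ _) = atomicDecomposition-RunInvariant _ r C' D' q u

  nondet-RunInvariant : ∀ {st e st'} → RunInvariant st → Unsolved st e → NondetOK Γ₀ st e st' →
                        RunInvariant st'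
  nondet-RunInvariant q u (decomposition {Cs} {s} {C} {D} m) = decomposition-RunInvariant _ Cs s C D q u m
  nondet-RunInvariant q u (extension {Cs} {D} {X} X∈ ac) = extension-RunInvariant _ Cs D X q u X∈ ac
  nondet-RunInvariant q u (localExtension {Cs} {X} {D} pD ac) = localExtension-RunInvariant _ Cs X D q u pD ac

  step-RunInvariant : ∀ {st st'} → RunInvariant st → Step Γ₀ st st' → RunInvariant st'
  step-RunInvariant q (eagerStep u ok) = eager-RunInvariant q u ok
  step-RunInvariant q (nondetStep _ u ok) = nondet-RunInvariant q u ok

-- The substitution σ_S of an acyclic assignment

subatoms : FAtom → List FAtom
subatoms (at A) = [ at A ]
subatoms (ex r A) = ex r A ∷ at A ∷ []

atomsOf : Elem → List FAtom
atomsOf (sub Cs D) = D ∷ Cs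
atomsOf (dis Cs Ds) = Cs ++ Ds

atoms : Problem → List FAtom
atoms Γ₀ = concatMap (λ e → concatMap subatoms (atomsOf e)) Γ₀

AtomOf⇒∈atomsOf : ∀ {b e} → AtomOf b e → b ∈ atomsOf e
AtomOf⇒∈atomsOf (subL m) = there m
AtomOf⇒∈atomsOf subR = here refl
AtomOf⇒∈atomsOf (disL m) = ∈-++⁺ˡ m
AtomOf⇒∈atomsOf (disR {Cs = Cs} m) = ∈-++⁺ʳ Cs m

SubAtom⇒∈subatoms : ∀ {a b} → SubAtom a b → a ∈ subatoms b
SubAtom⇒∈subatoms {b = at A} self = here refl
SubAtom⇒∈subatoms {b = ex r A} self = here refl
SubAtom⇒∈subatoms inEx = there (here refl)

InAt⇒∈atoms : ∀ {Γ₀ a} → InAt Γ₀ a → a ∈ atoms Γ₀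
InAt⇒∈atoms (e , e∈ , b , ab , sa) =
  ∈-concatMap⁺ _ (lose e∈ (∈-concatMap⁺ subatoms (lose (AtomOf⇒∈atomsOf ab) (SubAtom⇒∈subatoms sa))))

applyA-cong : ∀ {σ σ'} E → (∀ Y → OccursIn Y E → σ Y ≡ σ' Y) → applyA σ E ≡ applyA σ' E
applyA-cong (at (var X)) h = h X occAt
applyA-cong (at (con c)) h = refl
applyA-cong (ex r (var X)) h = cong (∃c r) (h X (occEx r))
applyA-cong (ex r (con c)) h = refl

applyL-cong : ∀ {σ σ'} Cs → (∀ E Y → E ∈ Cs → OccursIn Y E → σ Y ≡ σ' Y) →
              applyL σ Cs ≡ applyL σ' Cs
applyL-cong Cs h =
  cong ⨅ (ListP.map-cong-local (All.tabulate λ {E} E∈ → applyA-cong E (λ Y o → h E Y E∈ o)))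

applyA-Ground : ∀ {σ} → GroundSubst σ → ∀ E → Ground (applyA σ E)
applyA-Ground g (at (var X)) = g X
applyA-Ground g (at (con c)) = gcon c
applyA-Ground g (ex r (var X)) = g∃ (g X)
applyA-Ground g (ex r (con c)) = g∃ (gcon c)

⨅-Ground : ∀ Cs → (∀ C → C ∈ Cs → Ground C) → Ground (⨅ Cs)
⨅-Ground [] h = g⊤
⨅-Ground (C ∷ []) h = h C (here refl)
⨅-Ground (C ∷ Cs@(_ ∷ _)) h = g⊓ (h C (here refl)) (⨅-Ground Cs (λ D m → h D (there m)))

applyL-Ground : ∀ {σ} → GroundSubst σ → ∀ Cs → Ground (applyL σ Cs)
applyL-Ground {σ} g Cs = ⨅-Ground (map (applyA σ) Cs) ground
  where
  ground : ∀ C → C ∈ map (applyA σ) Cs → Ground C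
  ground C m with ∈-map⁻ (applyA σ) m
  ... | E , _ , refl = applyA-Ground g E

module σS-Construction (Γ₀ : Problem) (Sa : Assignment)
                      (assigned-InVar : ∀ {X E} → E ∈ Sa X → InVar Γ₀ X)
                      (assigned-InAtNv : ∀ {X E} → E ∈ Sa X → InAtNv Γ₀ E)
                      (acyclic : Acyclic Sa) where

  _▷_ : ℕ → ℕ → Set
  X ▷ Y = X ▷[ Sa ] Y

  σ-approx : ℕ → Subst
  σ-approx zero X = ⊤c
  σ-approx (suc k) X = applyL (σ-approx k) (Sa X)

  Chain : ℕ → ℕ → Set
  Chain k X = Σ (Vec ℕ k) λ xs → Linked _▷_ (X ∷ xs)

  σ-approx-stable : ∀ k X → ¬ Chain k X → ∀ m m' → k ≤ m → k ≤ m' → σ-approx m X ≡ σ-approx m' X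
  σ-approx-stable zero X ¬c m m' _ _ = ⊥-elim (¬c ([] , [-]))
  σ-approx-stable (suc k) X ¬c (suc m) (suc m') (s≤s p) (s≤s p') =
    applyL-cong (Sa X) (λ E Y E∈ o →
      σ-approx-stable k Y (λ { (ys , l) → ¬c (Y ∷ ys , (E , E∈ , o) ∷ l) }) m m' p p')

  ▷-InVar : ∀ {X Y} → X ▷ Y → InVar Γ₀ Y
  ▷-InVar (E , E∈ , occAt) = proj₁ (assigned-InAtNv E∈)
  ▷-InVar (E , E∈ , occEx r) with proj₁ (assigned-InAtNv E∈)
  ... | e , e∈ , b , ab , self = e , e∈ , b , ab , inEx

  Chain-InVar : ∀ {k X} {xs : Vec ℕ k} → Linked _▷_ (X ∷ xs) → ∀ i → InVar Γ₀ (lookup xs i)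
  Chain-InVar {xs = x ∷ xs} (r ∷ l) Fin.zero = ▷-InVar r
  Chain-InVar {xs = x ∷ xs} (r ∷ l) (Fin.suc i) = Chain-InVar l i

  N : ℕ
  N = length (atoms Γ₀)

  position : ∀ {k X} {xs : Vec ℕ k} → Linked _▷_ (X ∷ xs) → Fin k → Fin N
  position l i = Any.index (InAt⇒∈atoms (Chain-InVar l i))

  position-injective : ∀ {k X} {xs : Vec ℕ k} (l : Linked _▷_ (X ∷ xs)) {i j} →
                       position l i ≡ position l j → lookup xs i ≡ lookup xs j
  position-injective {xs = xs} l {i} {j} eq =
    cong unvar (trans (at-position i) (trans (cong (List.lookup (atoms Γ₀)) eq) (sym (at-position j))))
    where
    at-position : ∀ k → at (var (lookup xs k)) ≡ List.lookup (atoms Γ₀) (position l k)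
    at-position k = AnyP.lookup-index (InAt⇒∈atoms (Chain-InVar l k))
    unvar : FAtom → ℕ
    unvar (at (var Y)) = Y
    unvar _ = 0

  -- A chain through N + 1 variables visits some variable twice (pigeonhole on At),
  -- and the segment between the two visits is a cycle of >_S.
  ¬Chain-long : ∀ X → ¬ Chain (suc N) X
  ¬Chain-long X (xs , l) with FinP.pigeonhole (ℕP.n<1+n N) (position l)
  ... | i , j , i<j , same =
    acyclic (lookup xs i)
      (subst (TransClosure _▷_ (lookup xs i)) (sym (position-injective l same))
        (LinkedP.lookup⁺ (TC.transitive _▷_) (Linked.map TC.[_] (Linked.tail l)) i<j))

  σS : Subst
  σS = σ-approx (suc N)

  σS-unfold : ∀ X → σS X ≡ applyL σS (Sa X)
  σS-unfold X = applyL-cong (Sa X) (λ E Y E∈ o →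
    σ-approx-stable N Y (λ { (ys , l) → ¬Chain-long X (Y ∷ ys , (E , E∈ , o) ∷ l) })
      N (suc N) ℕP.≤-refl (ℕP.n≤1+n N))

  σ-approx-ground : ∀ k → GroundSubst (σ-approx k)
  σ-approx-ground zero X = g⊤
  σ-approx-ground (suc k) X = applyL-Ground (σ-approx-ground k) (Sa X)

  σS-ground : GroundSubst σS
  σS-ground = σ-approx-ground (suc N)

size : Concept → ℕ
size ⊤c = 1
size (nm _) = 1
size (C ⊓ D) = size C + size D
size (∃c r C) = suc (size C)

size-positive : ∀ C → 1 ≤ size C
size-positive ⊤c = s≤s z≤n
size-positive (nm _) = s≤s z≤n
size-positive (C ⊓ D) = ℕP.≤-trans (size-positive C) (ℕP.m≤m+n (size C) (size D))
size-positive (∃c r C) = s≤s z≤n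

size-⨅-≤ : ∀ cs {c} → c ∈ cs → size c ≤ size (⨅ cs)
size-⨅-≤ (c ∷ []) (here refl) = ℕP.≤-refl
size-⨅-≤ (c ∷ cs@(_ ∷ _)) (here refl) = ℕP.m≤m+n (size c) (size (⨅ cs))
size-⨅-≤ (c₁ ∷ cs@(_ ∷ _)) (there m) =
  ℕP.≤-trans (size-⨅-≤ cs m) (ℕP.m≤n+m (size (⨅ cs)) (size c₁))

size-⨅-< : ∀ cs {c} → c ∈ cs → length cs ≢ 1 → size c < size (⨅ cs)
size-⨅-< (c ∷ []) m len = ⊥-elim (len refl)
size-⨅-< (c ∷ cs@(_ ∷ _)) (here refl) len =
  ℕP.≤-trans (ℕP.≤-reflexive (ℕP.+-comm 1 (size c))) (ℕP.+-monoʳ-≤ (size c) (size-positive (⨅ cs)))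
size-⨅-< (c₁ ∷ cs@(_ ∷ _)) (there m) len = ℕP.+-mono-≤ (size-positive c₁) (size-⨅-≤ cs m)

-- The two ways in which the lexicographic measure k * a + x (with x < k) decreases.
weight-<-major : ∀ k {a b x x'} → a < b → x < k → k * a + x < k * b + x'
weight-<-major k {a} {b} {x} {x'} a<b x<k = begin-strict
  k * a + x     <⟨ ℕP.+-monoʳ-< (k * a) x<k ⟩
  k * a + k     ≡⟨ trans (ℕP.+-comm (k * a) k) (sym (ℕP.*-suc k a)) ⟩
  k * suc a     ≤⟨ ℕP.*-monoʳ-≤ k a<b ⟩
  k * b         ≤⟨ ℕP.m≤m+n (k * b) x' ⟩
  k * b + x'    ∎
  where open ℕP.≤-Reasoning

weight-<-minor : ∀ k {a b x x'} → a ≤ b → x < x' → k * a + x < k * b + x'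
weight-<-minor k a≤b x<x' = ℕP.+-mono-≤-< (ℕP.*-monoʳ-≤ k a≤b) x<x'

varCount : FAtom → ℕ
varCount (at (var _)) = 1
varCount (at (con _)) = 0
varCount (ex _ _) = 0

varCount-≤ : ∀ D → varCount D ≤ 1
varCount-≤ (at (var _)) = ℕP.≤-refl
varCount-≤ (at (con _)) = z≤n
varCount-≤ (ex _ _) = z≤n

varCount-NonVar : ∀ {D} → NonVar D → varCount D ≡ 0
varCount-NonVar {at (var X)} nv = ⊥-elim (nv (isVar X))
varCount-NonVar {at (con _)} nv = refl
varCount-NonVar {ex _ _} nv = refl

varCount-NonVar<1 : ∀ {D} → NonVar D → varCount D < 1
varCount-NonVar<1 nv = ℕP.≤-reflexive (cong suc (varCount-NonVar nv))

singleVarCount : List FAtom → ℕ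
singleVarCount (at (var _) ∷ []) = 1
singleVarCount _ = 0

singleVarCount-≤ : ∀ Cs → singleVarCount Cs ≤ 1
singleVarCount-≤ [] = z≤n
singleVarCount-≤ (at (var _) ∷ []) = ℕP.≤-refl
singleVarCount-≤ (at (con _) ∷ []) = z≤n
singleVarCount-≤ (ex _ _ ∷ []) = z≤n
singleVarCount-≤ (at (var _) ∷ _ ∷ _) = z≤n
singleVarCount-≤ (at (con _) ∷ _ ∷ _) = z≤n
singleVarCount-≤ (ex _ _ ∷ _ ∷ _) = z≤n

singleVarCount-NonVar : ∀ {E} → NonVar E → singleVarCount [ E ] ≡ 0
singleVarCount-NonVar {at (var X)} nv = ⊥-elim (nv (isVar X))
singleVarCount-NonVar {at (con _)} nv = refl
singleVarCount-NonVar {ex _ _} nv = refl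

varCounts-< : ∀ Cs D → singleVarCount Cs + varCount D < 3
varCounts-< Cs D = s≤s (ℕP.+-mono-≤ (singleVarCount-≤ Cs) (varCount-≤ D))

applyA-∃ : ∀ σ s C → applyA σ (ex s C) ≡ ∃c s (applyA σ (at C))
applyA-∃ σ s (var X) = refl
applyA-∃ σ s (con c) = refl

size-applyA-∃ : ∀ σ s C → size (applyA σ (at C)) < size (applyA σ (ex s C))
size-applyA-∃ σ s C rewrite applyA-∃ σ s C = ℕP.≤-refl

applyA-Atomic : ∀ σ {D} → NonVar D → Atomic (applyA σ D)
applyA-Atomic σ {at (var X)} nv = ⊥-elim (nv (isVar X))
applyA-Atomic σ {at (con c)} nv = nm _
applyA-Atomic σ {ex r (var X)} nv = ∃c _ _
applyA-Atomic σ {ex r (con c)} nv = ∃c _ _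

applyA-GroundAtom : ∀ σ {a} → GroundAtom a → applyA σ a ≡ atomC a
applyA-GroundAtom σ (gAt c) = refl
applyA-GroundAtom σ (gEx r c) = refl

applyL-GroundAtoms : ∀ σ Cs → (∀ a → a ∈ Cs → GroundAtom a) → applyL σ Cs ≡ ⨅ (map atomC Cs)
applyL-GroundAtoms σ Cs h =
  cong ⨅ (ListP.map-cong-local (All.tabulate λ {a} a∈ → applyA-GroundAtom σ (h a a∈)))

applyL-⊑-∈ : ∀ σ {Cs C} → C ∈ Cs → applyL σ Cs ⊑ applyA σ C
applyL-⊑-∈ σ {Cs} {C} m = ⨅-lowerBound {applyA σ C} (map (applyA σ) Cs) (∈-map⁺ (applyA σ) m)

⨅-⋢-Atomic : ∀ σ Es {D} → NonVar D → (∀ {E} → E ∈ Es → ¬ (applyA σ E ⊑ applyA σ D)) →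
             ¬ (applyL σ Es ⊑ applyA σ D)
⨅-⋢-Atomic σ Es nv ⋢ k with ⨅-⊑-Atomic (map (applyA σ) Es) (applyA-Atomic σ nv) k
... | c , c∈ , c⊑ with ∈-map⁻ (applyA σ) c∈
...   | E , E∈ , refl = ⋢ E∈ c⊑

initSolved-dis : ∀ Cs D → T (initSolved (dis Cs [ D ])) → Σ ℕ λ X → Cs ≡ [ at (var X) ] × NonVar D
initSolved-dis (at (var X) ∷ []) (at (con c)) t = X , refl , λ ()
initSolved-dis (at (var X) ∷ []) (ex r A) t = X , refl , λ ()

module FinalState (Γ₀ : Problem) (st : State) (I : WellFormed.Invariant Γ₀ st)
                  (J : SolvedJustified st) (C : Expanded st) (allSolved : AllSolved st) where
  open WellFormed Γ₀
  open σS-Construction Γ₀ (S st) (assigned-InVar I) (assigned-InAtNv I) (acyclic I)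

  σ⊑assigned : ∀ {X E} → E ∈ S st X → σS X ⊑ applyA σS E
  σ⊑assigned {X} {E} E∈ =
    subst (_⊑ applyA σS E) (sym (σS-unfold X)) (applyL-⊑-∈ σS E∈)

  size-assigned-≤ : ∀ {X E} → E ∈ S st X → size (applyA σS E) ≤ size (σS X)
  size-assigned-≤ {X} E∈ =
    subst (λ c → _ ≤ size c) (sym (σS-unfold X))
      (size-⨅-≤ (map (applyA σS) (S st X)) (∈-map⁺ (applyA σS) E∈))

  subMeasure : FAtom → ℕ
  subMeasure D = 2 * size (applyA σS D) + varCount D

  sub-holds : ∀ {Cs D} → Acc _<_ (subMeasure D) → sub Cs D ∈ Γ st → applyL σS Cs ⊑ applyA σS D
  sub-holds {Cs} {D} (acc rec) m with J (sub Cs D) (allSolved _ m)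
  sub-holds {Cs} {at (var X)} (acc rec) m | inj₁ _ =
    subst (applyL σS Cs ⊑_) (sym (σS-unfold X)) (⨅-greatest {applyL σS Cs} (map (applyA σS) (S st X)) below)
    where
    below : ∀ c → c ∈ map (applyA σS) (S st X) → applyL σS Cs ⊑ c
    below c c∈ with ∈-map⁻ (applyA σS) c∈
    ... | E , E∈ , refl =
      sub-holds (rec (weight-<-minor 2 (size-assigned-≤ E∈) (varCount-NonVar<1 (proj₂ (assigned-InAtNv I E∈)))))
                (C X (viaSub m E∈))
  sub-holds {D = at (con c)} _ _ | inj₁ ()
  sub-holds {D = ex r A} _ _ | inj₁ ()
  sub-holds {Cs} {D} _ _ | inj₂ (byGroundSolving (gs , gD) h) =
    subst₂ _⊑_ (sym (applyL-GroundAtoms σS Cs gs)) (sym (applyA-GroundAtom σS gD)) h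
  sub-holds _ _ | inj₂ (bySolving (C' , C'∈ , inj₁ refl)) = applyL-⊑-∈ σS C'∈
  sub-holds {Cs} {D} _ _ | inj₂ (bySolving (_ , X∈ , inj₂ (X , refl , D∈))) =
    ⊑-trans {applyL σS Cs} {σS X} {applyA σS D} (applyL-⊑-∈ σS X∈) (σ⊑assigned D∈)
  sub-holds {Cs} {ex s D'} (acc rec) _ | inj₂ (byDecomposition {C = C'} m' g) =
    ⊑-trans {applyL σS Cs} {applyA σS (ex s C')} {applyA σS (ex s D')} (applyL-⊑-∈ σS m')
      (subst₂ _⊑_ (sym (applyA-∃ σS s C')) (sym (applyA-∃ σS s D'))
        (∃c-mono-⊑ {s} {applyA σS (at C')} {applyA σS (at D')}
          (sub-holds (rec (weight-<-major 2 (size-applyA-∃ σS s D') (s≤s (varCount-≤ (at D'))))) g)))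

  disMeasure : List FAtom → FAtom → ℕ
  disMeasure Cs D = 3 * size (applyL σS Cs) + (singleVarCount Cs + varCount D)

  dis-holds : ∀ {Cs D} → Acc _<_ (disMeasure Cs D) → dis Cs [ D ] ∈ Γ st → ¬ (applyL σS Cs ⊑ applyA σS D)
  dis-holds {Cs} {D} (acc rec) m with J (dis Cs [ D ]) (allSolved _ m)
  ... | inj₁ t with initSolved-dis Cs D t
  ...   | X , refl , nvD =
    λ X⊑D → ⨅-⋢-Atomic σS (S st X) nvD below (subst (_⊑ applyA σS D) (σS-unfold X) X⊑D)
    where
    below : ∀ {E} → E ∈ S st X → ¬ (applyA σS E ⊑ applyA σS D)
    below E∈ = dis-holds
      (rec (weight-<-minor 3 (size-assigned-≤ E∈)
             (ℕP.≤-reflexive (cong (λ n → suc (n + varCount D))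
               (singleVarCount-NonVar (proj₂ (assigned-InAtNv I E∈)))))))
      (C X (viaDis m (NonVar⇒¬isVarB nvD) E∈))
  dis-holds {Cs} {D} _ _ | inj₂ (byGroundSolving (gs , gDs) ⋢) =
    λ k → ⋢ (subst₂ _⊑_ (applyL-GroundAtoms σS Cs gs) (applyA-GroundAtom σS (gDs D (here refl))) k)
  dis-holds {Cs} {D} (acc rec) _ | inj₂ (byLeftDecomposition nv len below) =
    ⨅-⋢-Atomic σS Cs nv
      (λ E∈ → dis-holds (rec (weight-<-major 3 (smaller E∈) (varCounts-< _ D))) (below _ E∈))
    where
    smaller : ∀ {E} → E ∈ Cs → size (applyA σS E) < size (applyL σS Cs)
    smaller E∈ = size-⨅-< (map (applyA σS) Cs) (∈-map⁺ (applyA σS) E∈)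
                   (λ eq → len (trans (sym (ListP.length-map (applyA σS) Cs)) eq))
  dis-holds _ _ | inj₂ (byGroundAtoms gC gD ⋢) =
    λ k → ⋢ (subst₂ _⊑_ (applyA-GroundAtom σS gC) (applyA-GroundAtom σS gD) k)
  dis-holds {at (con c) ∷ []} {ex r A} _ _ | inj₂ byConstant⋢∃ =
    λ k → nm⋢∃c {con c} {r} {applyA σS (at A)} (subst (nm (con c) ⊑_) (applyA-∃ σS r A) k)
  dis-holds {ex r A ∷ []} {at (con c)} _ _ | inj₂ by∃⋢Constant =
    λ k → ∃c⋢nm {con c} {r} {applyA σS (at A)} (subst (_⊑ nm (con c)) (applyA-∃ σS r A) k)
  dis-holds {ex r C' ∷ []} {ex s D'} _ _ | inj₂ (byRoleClash r≢s) =
    λ k → r≢s (proj₁ (∃c⊑∃c⇒ {r} {s} {applyA σS (at C')} {applyA σS (at D')}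
                         (subst₂ _⊑_ (applyA-∃ σS r C') (applyA-∃ σS s D') k)))
  dis-holds {ex r C' ∷ []} {ex .r D'} (acc rec) _ | inj₂ (byAtomicDecomposition g) =
    λ k → dis-holds (rec (weight-<-major 3 (size-applyA-∃ σS r C') (varCounts-< [ at C' ] (at D')))) g
            (proj₂ (∃c⊑∃c⇒ {r} {r} {applyA σS (at C')} {applyA σS (at D')}
                     (subst₂ _⊑_ (applyA-∃ σS r C') (applyA-∃ σS r D') k)))
  dis-holds {Cs} {at (var X)} (acc rec) _ | inj₂ (byLocalExtension {D = D'} D'∈ g) =
    λ k → dis-holds (rec (weight-<-minor 3 (ℕP.≤-refl {size (applyL σS Cs)})
                           (ℕP.+-monoʳ-< (singleVarCount Cs) (varCount-NonVar<1 (proj₂ (assigned-InAtNv I D'∈))))))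
            g (⊑-trans {applyL σS Cs} {σS X} {applyA σS D'} k (σ⊑assigned D'∈))

  solves-all : ∀ e → e ∈ Γ st → Solves σS e
  solves-all (sub Cs D) m = sub-holds (<-wellFounded _) m
  solves-all (dis Cs Ds) m with wellFormed I m
  ... | _ , D , refl , _ = dis-holds (<-wellFounded _) m

  localSolution : HasLocalSolution Γ₀
  localSolution =
    S st , isAssignment , acyclic I , σS , (λ X _ → σS-unfold X) ,
    σS-ground , (λ e m → solves-all e (Γ₀⊆Γ I e m))
    where
    isAssignment : IsAssignment Γ₀ (S st)
    isAssignment X = (λ _ a m → assigned-InAtNv I m) , unassigned
      where
      unassigned : ¬ InVar Γ₀ X → S st X ≡ []
      unassigned ¬X with S st X in eq
      ... | [] = refl
      ... | E ∷ _ = ⊥-elim (¬X (assigned-InVar I (subst (E ∈_) (sym eq) (here refl))))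

module _ (Γ₀ : Problem) where
  open WellFormed Γ₀
  open Soundness Γ₀

  initState-WF : SingleRHS Γ₀ → ∀ {e} → e ∈ Γ₀ → WF e
  initState-WF _ {sub Cs D} m = inj₁ (_ , m , refl) , (_ , m , D , subR , self)
  initState-WF single {dis Cs Ds} m = dis-WF m (single Cs Ds m)
    where
    dis-WF : ∀ {Cs Ds} → dis Cs Ds ∈ Γ₀ → length Ds ≡ 1 → WF (dis Cs Ds)
    dis-WF {Ds = D ∷ []} m _ = inj₁ (_ , m , refl) , D , refl , (_ , m , D , disR (here refl) , self)

  initState-Invariant : SingleRHS Γ₀ → Invariant (initState Γ₀)
  initState-Invariant single = record
    { Γ₀⊆Γ = λ e m → m
    ; wellFormed = initState-WF single
    ; initSolved∈Sol = λ e m t → ∈-filter⁺ (λ e → T? (initSolved e)) m t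
    ; assigned-InAtNv = λ ()
    ; assigned-InVar = λ ()
    ; acyclic = λ { X TC.[ _ , () , _ ] ; X ((_ , () , _) TC.∷ _) } }

  initState-RunInvariant : SingleRHS Γ₀ → RunInvariant (initState Γ₀)
  initState-RunInvariant single =
    initState-Invariant single ,
    (λ e m → inj₁ (proj₂ (∈-filter⁻ (λ e → T? (initSolved e)) {xs = Γ₀} m))) ,
    (λ { X (viaSub _ ()) ; X (viaDis _ _ ()) })

  run-final : ∀ {st} → RunInvariant st → SuccessfulRun Γ₀ st →
              Σ State λ st' → RunInvariant st' × AllSolved st'
  run-final q (done all) = _ , q , all
  run-final q (step s r) = run-final (step-RunInvariant q s) r

  soundness : SingleRHS Γ₀ → SuccessfulRun Γ₀ (initState Γ₀) → HasLocalSolution Γ₀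
  soundness single r with run-final (initState-RunInvariant single) r
  ... | st , (I , J , C) , all = FinalState.localSolution Γ₀ st I J C all

All∈? : ∀ {A : Set} {P : A → Set} → (∀ a → Dec (P a)) → ∀ xs → Dec (∀ a → a ∈ xs → P a)
All∈? P? xs = map′ (λ all a m → All.lookup all m) (λ h → All.tabulate (λ {a} m → h a m)) (all? P? xs)

Any∈? : ∀ {A : Set} {ℓ} {P : A → Set ℓ} → (∀ a → Dec (P a)) → ∀ xs →
        Dec (Σ A λ a → a ∈ xs × P a)
Any∈? P? xs = map′ find (λ (a , m , p) → lose m p) (any? P? xs)

GroundAtom? : ∀ a → Dec (GroundAtom a)
GroundAtom? (at (var X)) = no λ ()
GroundAtom? (at (con c)) = yes (gAt c)
GroundAtom? (ex r (var X)) = no λ ()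
GroundAtom? (ex r (con c)) = yes (gEx r c)

GroundElem? : ∀ e → Dec (GroundElem e)
GroundElem? (sub Cs D) with All∈? GroundAtom? Cs | GroundAtom? D
... | yes p | yes q = yes (p , q)
... | no p | _ = no λ z → p (proj₁ z)
... | _ | no q = no λ z → q (proj₂ z)
GroundElem? (dis Cs Ds) with All∈? GroundAtom? Cs | All∈? GroundAtom? Ds
... | yes p | yes q = yes (p , q)
... | no p | _ = no λ z → p (proj₁ z)
... | _ | no q = no λ z → q (proj₂ z)

NonVar? : ∀ D → Dec (NonVar D)
NonVar? (at (var X)) = no λ nv → nv (isVar X)
NonVar? (at (con c)) = yes λ ()
NonVar? (ex r A) = yes λ ()

SolvCond? : ∀ (Sa : Assignment) Cs D → Dec (SolvCond Sa Cs D)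
SolvCond? Sa Cs D = Any∈? solves Cs
  where
  solves : ∀ C → Dec (C ≡ D ⊎ Σ ℕ λ X → C ≡ at (var X) × D ∈ Sa X)
  solves C with C ≟A D
  ... | yes p = yes (inj₁ p)
  solves (at (var X)) | no p with D ∈A? Sa X
  ... | yes q = yes (inj₂ (X , refl , q))
  ... | no q = no λ { (inj₁ r) → p r ; (inj₂ (_ , refl , r)) → q r }
  solves (at (con c)) | no p = no λ { (inj₁ r) → p r ; (inj₂ (_ , () , _)) }
  solves (ex r A) | no p = no λ { (inj₁ r) → p r ; (inj₂ (_ , () , _)) }

ExtCond? : ∀ (Sa : Assignment) Cs → Dec (Σ ℕ (ExtCond Sa Cs))
ExtCond? Sa Cs = map′ (λ { (_ , m , X , refl , h) → X , m , h }) (λ { (X , m , h) → _ , m , X , refl , h })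
                      (Any∈? extendable Cs)
  where
  extendable : ∀ C →
    Dec (Σ ℕ λ X → C ≡ at (var X) × (∀ C' → C' ∈ Cs → C' ≡ at (var X) ⊎ C' ∈ Sa X))
  extendable (at (var X)) with All∈? covered Cs
    where
    covered : ∀ C' → Dec (C' ≡ at (var X) ⊎ C' ∈ Sa X)
    covered C' with C' ≟A at (var X) | C' ∈A? Sa X
    ... | yes p | _ = yes (inj₁ p)
    ... | no _ | yes q = yes (inj₂ q)
    ... | no p | no q = no λ { (inj₁ r) → p r ; (inj₂ r) → q r }
  ... | yes h = yes (X , refl , h)
  ... | no h = no λ { (_ , refl , h') → h h' }
  extendable (at (con c)) = no λ { (_ , () , _) }
  extendable (ex r A) = no λ { (_ , () , _) }

countOutside : List Elem → List Elem → ℕ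
countOutside [] A = 0
countOutside (u ∷ us) A with u ∈E? A
... | yes _ = countOutside us A
... | no _ = suc (countOutside us A)

countOutside-mono : ∀ us {A B} → (∀ {x} → x ∈ A → x ∈ B) → countOutside us B ≤ countOutside us A
countOutside-mono [] h = z≤n
countOutside-mono (u ∷ us) {A} {B} h with u ∈E? A | u ∈E? B
... | yes _ | yes _ = countOutside-mono us h
... | yes p | no q = ⊥-elim (q (h p))
... | no _ | yes _ = ℕP.m≤n⇒m≤1+n (countOutside-mono us h)
... | no _ | no _ = s≤s (countOutside-mono us h)

countOutside-< : ∀ us {A B e} → (∀ {x} → x ∈ A → x ∈ B) → e ∈ us → e ∉ A → e ∈ B →
                 countOutside us B < countOutside us A
countOutside-< (u ∷ us) {A} {B} h (here refl) e∉A e∈B with u ∈E? A | u ∈E? B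
... | yes p | _ = ⊥-elim (e∉A p)
... | no _ | yes _ = s≤s (countOutside-mono us h)
... | no _ | no q = ⊥-elim (q e∈B)
countOutside-< (u ∷ us) {A} {B} h (there m) e∉A e∈B with u ∈E? A | u ∈E? B
... | yes _ | yes _ = countOutside-< us h m e∉A e∈B
... | yes p | no q = ⊥-elim (q (h p))
... | no _ | yes _ = ℕP.<-trans (countOutside-< us h m e∉A e∈B) (ℕP.n<1+n _)
... | no _ | no _ = s≤s (countOutside-< us h m e∉A e∈B)

module Candidates (Γ₀ : Problem) where
  open WellFormed Γ₀

  -- Every element a run can create lies in this finite list, so solving one is progress.
  candidates : List Elem
  candidates = concatMap (λ Cs → concatMap (λ D → sub Cs D ∷ dis Cs [ D ] ∷ []) (atoms Γ₀))
                         (map lhs Γ₀ ++ map [_] (atoms Γ₀))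

  AdmissibleLhs⇒∈ : ∀ {Cs} → AdmissibleLhs Cs → Cs ∈ map lhs Γ₀ ++ map [_] (atoms Γ₀)
  AdmissibleLhs⇒∈ (inj₁ (e , m , refl)) = ∈-++⁺ˡ (∈-map⁺ lhs m)
  AdmissibleLhs⇒∈ (inj₂ (C , refl , p)) = ∈-++⁺ʳ (map lhs Γ₀) (∈-map⁺ [_] (InAt⇒∈atoms p))

  pair⇒∈candidates : ∀ {Cs D e} → AdmissibleLhs Cs → InAt Γ₀ D → e ∈ sub Cs D ∷ dis Cs [ D ] ∷ [] →
                     e ∈ candidates
  pair⇒∈candidates lo pD m =
    ∈-concatMap⁺ _ (lose (AdmissibleLhs⇒∈ lo) (∈-concatMap⁺ _ (lose (InAt⇒∈atoms pD) m)))

  WF⇒∈candidates : ∀ {e} → WF e → e ∈ candidates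
  WF⇒∈candidates {sub Cs D} (lo , pD) = pair⇒∈candidates lo pD (here refl)
  WF⇒∈candidates {dis Cs Ds} (lo , D , refl , pD) = pair⇒∈candidates lo pD (there (here refl))

-- Completeness: a run guided by a local solution

-- Along an edge X >_S Y we have σ(X) ⊑ ∃r.σ(Y), so the role depth of σ strictly decreases.
Acyclic-below : ∀ (σ : Subst) (Sa : Assignment) →
                (∀ {X E} → E ∈ Sa X → NonVar E × (σ X ⊑ applyA σ E)) → Acyclic Sa
Acyclic-below σ Sa below X cycle = ℕP.<-irrefl refl (decreasing cycle)
  where
  edge : ∀ {X Y} → X ▷[ Sa ] Y → roleDepth (σ Y) < roleDepth (σ X)
  edge (E , E∈ , occAt) = ⊥-elim (proj₁ (below E∈) (isVar _))
  edge {X} {Y} (E , E∈ , occEx r) = ⊑⇒roleDepth-≥ {σ X} {∃c r (σ Y)} (proj₂ (below E∈))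
  decreasing : ∀ {X Y} → TransClosure (λ X Y → X ▷[ Sa ] Y) X Y → roleDepth (σ Y) < roleDepth (σ X)
  decreasing TC.[ s ] = edge s
  decreasing (s TC.∷ p) = ℕP.<-trans (decreasing p) (edge s)

¬EagerApplicable-sub : ∀ st {Cs D} → ¬ GroundElem (sub Cs D) → ¬ SolvCond (S st) Cs D →
                       ¬ Σ ℕ (ExtCond (S st) Cs) → ¬ EagerApplicable st (sub Cs D)
¬EagerApplicable-sub _ ¬g ¬s ¬x (inj₁ g) = ¬g g
¬EagerApplicable-sub _ ¬g ¬s ¬x (inj₂ (inj₁ s)) = ¬s s
¬EagerApplicable-sub _ ¬g ¬s ¬x (inj₂ (inj₂ (inj₁ x))) = ¬x x
¬EagerApplicable-sub _ ¬g ¬s ¬x (inj₂ (inj₂ (inj₂ (inj₁ ()))))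
¬EagerApplicable-sub _ ¬g ¬s ¬x (inj₂ (inj₂ (inj₂ (inj₂ (inj₁ ())))))
¬EagerApplicable-sub _ ¬g ¬s ¬x (inj₂ (inj₂ (inj₂ (inj₂ (inj₂ ())))))

¬EagerApplicable-dis : ∀ st {Cs D} → ¬ GroundElem (dis Cs [ D ]) → ¬ SolvCond (S st) Cs D →
                       ¬ LDApp (dis Cs [ D ]) → ¬ ADApp (dis Cs [ D ]) → ¬ EagerApplicable st (dis Cs [ D ])
¬EagerApplicable-dis _ ¬g ¬s ¬ld ¬ad (inj₁ g) = ¬g g
¬EagerApplicable-dis _ ¬g ¬s ¬ld ¬ad (inj₂ (inj₁ s)) = ¬s s
¬EagerApplicable-dis _ ¬g ¬s ¬ld ¬ad (inj₂ (inj₂ (inj₁ ())))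
¬EagerApplicable-dis _ ¬g ¬s ¬ld ¬ad (inj₂ (inj₂ (inj₂ (inj₁ ()))))
¬EagerApplicable-dis _ ¬g ¬s ¬ld ¬ad (inj₂ (inj₂ (inj₂ (inj₂ (inj₁ ld))))) = ¬ld ld
¬EagerApplicable-dis _ ¬g ¬s ¬ld ¬ad (inj₂ (inj₂ (inj₂ (inj₂ (inj₂ ad))))) = ¬ad ad

¬GroundAtoms : ∀ {C D} → ¬ GroundElem (dis [ C ] [ D ]) → ¬ (GroundAtom C × GroundAtom D)
¬GroundAtoms ¬g (gC , gD) = ¬g ((λ { a (here refl) → gC }) , (λ { a (here refl) → gD }))

singleton? : ∀ {A : Set} (xs : List A) → (Σ A λ x → xs ≡ [ x ]) ⊎ length xs ≢ 1
singleton? [] = inj₂ λ ()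
singleton? (x ∷ []) = inj₁ (x , refl)
singleton? (x ∷ _ ∷ _) = inj₂ λ ()

¬NonVar⇒var : ∀ {C} → ¬ NonVar C → Σ ℕ λ Y → C ≡ at (var Y)
¬NonVar⇒var {at (var Y)} _ = Y , refl
¬NonVar⇒var {at (con c)} ¬nv = ⊥-elim (¬nv λ ())
¬NonVar⇒var {ex r A} ¬nv = ⊥-elim (¬nv λ ())

ADApp⇒NonVar : ∀ Cs {D} → ADApp (dis Cs [ D ]) → NonVar D
ADApp⇒NonVar (C ∷ []) (_ , nvD) = nvD

NonVar⇒initSolved : ∀ {Y D} → NonVar D → T (initSolved (dis [ at (var Y) ] [ D ]))
NonVar⇒initSolved {D = at (var Z)} nv = ⊥-elim (nv (isVar Z))
NonVar⇒initSolved {D = at (con _)} nv = tt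
NonVar⇒initSolved {D = ex _ _} nv = tt

module Completeness (Γ₀ : Problem) (S₀ : Assignment) (S₀-assignment : IsAssignment Γ₀ S₀)
                    (σ : Subst) (σ-local : IsσS Γ₀ S₀ σ) where
  open WellFormed Γ₀
  open Candidates Γ₀

  Solves-Γ : State → Set₁
  Solves-Γ st = ∀ e → e ∈ Γ st → Solves σ e

  σ-below-S : State → Set₁
  σ-below-S st = ∀ {X E} → E ∈ S st X → σ X ⊑ applyA σ E

  Guided : State → Set₁
  Guided st = Invariant st × Solves-Γ st × σ-below-S st

  addE-Guided : ∀ st e → WF e × Solves σ e → Guided st → Guided (addE e st)
  addE-Guided st e (w , s) (I , G , H) = addE-Invariant st e w I , G' , H'
    where
    G' : Solves-Γ (addE e st)
    G' x m with addE-Γ⁻ e st m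
    ... | inj₁ p = G x p
    ... | inj₂ refl = s
    H' : σ-below-S (addE e st)
    H' {X} m = H (subst (λ S' → _ ∈ S' X) (addE-S e st) m)

  Expansion-Solves : ∀ st X {x} → Guided st → Expansion X (S st X) (Γ st) x → Solves σ x
  Expansion-Solves st X (I , G , H) (viaSub {Cs} {E} m E∈) =
    ⊑-trans {applyL σ Cs} {σ X} {applyA σ E} (G _ m) (H E∈)
  Expansion-Solves st X (I , G , H) (viaDis {E} {D} m t E∈) =
    λ E⊑D → G _ m (⊑-trans {σ X} {applyA σ E} {applyA σ D} (H E∈) E⊑D)

  expand-Guided : ∀ st X → Guided st → Guided (expand X st)
  expand-Guided st X g = addAll-preserves Guided (expandNew X (S st X) (Γ st))
    (λ st' e m g' → let p = expandNew⁻ X (S st X) (Γ st) m in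
       addE-Guided st' e (Expansion-WF st X (proj₁ g) p , Expansion-Solves st X g p) g') st g

  markSolved-Guided : ∀ st e → Guided st → Guided (markSolved e st)
  markSolved-Guided st e (I , G , H) = markSolved-Invariant st e I , G , H

  addS-Guided : ∀ st X D → InAtNv Γ₀ D → InVar Γ₀ X → σ X ⊑ applyA σ D → Guided st →
                Σ (Acyclic (addS X D (S st))) λ _ → Guided (setS (addS X D (S st)) st)
  addS-Guided st X D pD pX X⊑D (I , G , H) = acyclic' , addS-Invariant st X D pD pX acyclic' I , G , H'
    where
    H' : ∀ {Y E} → E ∈ addS X D (S st) Y → σ Y ⊑ applyA σ E
    H' {Y} m with addS⁻ X D (S st) {Y} m
    ... | inj₁ p = H p
    ... | inj₂ (refl , refl) = X⊑D
    nonVar : ∀ {Y E} → E ∈ addS X D (S st) Y → NonVar E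
    nonVar {Y} m with addS⁻ X D (S st) {Y} m
    ... | inj₁ p = proj₂ (assigned-InAtNv I p)
    ... | inj₂ (_ , refl) = proj₂ pD
    acyclic' : Acyclic (addS X D (S st))
    acyclic' = Acyclic-below σ (addS X D (S st)) (λ {Y} m → nonVar {Y} m , H' {Y} m)

  module Guided-Preservation =
    Preservation Guided (λ e → WF e × Solves σ e) addE-Guided expand-Guided

  Progress : State → Set₁
  Progress st = Σ State λ st' → Step Γ₀ st st' × Guided st' ×
                  countOutside candidates (Sol st') < countOutside candidates (Sol st)

  markSolved-progress : ∀ st st₁ e → st ≼ st₁ → Unsolved st e → WF e →
                        countOutside candidates (Sol (markSolved e st₁)) < countOutside candidates (Sol st)
  markSolved-progress st st₁ e p u w =
    countOutside-< candidates (λ m → markSolved-Sol⁺ e st₁ (Sol-mono p m)) (WF⇒∈candidates w) (proj₂ u)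
      (markSolved-self e st₁)

  SolvCond-⊑ : ∀ st {Cs D} → σ-below-S st → SolvCond (S st) Cs D → applyL σ Cs ⊑ applyA σ D
  SolvCond-⊑ st H (C , C∈ , inj₁ refl) = applyL-⊑-∈ σ C∈
  SolvCond-⊑ st {Cs} {D} H (C , X∈ , inj₂ (X , refl , D∈)) =
    ⊑-trans {applyL σ Cs} {σ X} {applyA σ D} (applyL-⊑-∈ σ X∈) (H D∈)

  Guided-HoldsGround : ∀ st e → Solves-Γ st → e ∈ Γ st → GroundElem e → HoldsGround e
  Guided-HoldsGround st (sub Cs D) G m (gs , gD) =
    subst₂ _⊑_ (applyL-GroundAtoms σ Cs gs) (applyA-GroundAtom σ gD) (G _ m)
  Guided-HoldsGround st (dis Cs Ds) G m (gs , gDs) =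
    λ k → G _ m (subst₂ _⊑_ (sym (applyL-GroundAtoms σ Cs gs)) (sym (applyL-GroundAtoms σ Ds gDs)) k)

  extension-progress : ∀ st Cs D X → Guided st → Unsolved st (sub Cs D) → at (var X) ∈ Cs →
    σ X ⊑ applyA σ D →
    Σ (Acyclic (addS X D (S st))) λ _ →
      Guided (markSolved (sub Cs D) (expand X (setS (addS X D (S st)) st))) ×
      countOutside candidates (Sol (markSolved (sub Cs D) (expand X (setS (addS X D (S st)) st))))
        < countOutside candidates (Sol st)
  extension-progress st Cs D X g@(I , _) u X∈ X⊑D with wellFormed I (proj₁ u)
  ... | lo , pD with addS-Guided st X D (pD , unsolved-sub-NonVar I u) (AdmissibleLhs-InAt lo X∈) X⊑D g
  ...   | ac , g₁ =
    ac , markSolved-Guided _ _ (expand-Guided _ X g₁) ,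
    markSolved-progress st _ (sub Cs D) (≼-trans (addS-≼ X D st) (expand-≼ X _)) u (lo , pD)

  solved-progress : ∀ st e → Unsolved st e → Guided st → EagerOK Γ₀ st e (markSolved e st) → Progress st
  solved-progress st e u g@(I , _) ok =
    markSolved e st , eagerStep u ok , markSolved-Guided st e g ,
    markSolved-progress st st e ≼-refl u (wellFormed I (proj₁ u))

  atomicDecomposition-progress : ∀ st C D → Guided st → Unsolved st (dis [ C ] [ D ]) →
    ¬ GroundElem (dis [ C ] [ D ]) → ¬ SolvApp (S st) (dis [ C ] [ D ]) →
    NonVar C → NonVar D → Progress st
  atomicDecomposition-progress st (at (var x)) D g u ¬gr ¬sc nvC nvD = ⊥-elim (nvC (isVar x))
  atomicDecomposition-progress st C (at (var y)) g u ¬gr ¬sc nvC nvD = ⊥-elim (nvD (isVar y))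
  atomicDecomposition-progress st (at (con c)) (at (con d)) g u ¬gr ¬sc nvC nvD =
    ⊥-elim (¬GroundAtoms ¬gr (gAt c , gAt d))
  atomicDecomposition-progress st (at (con c)) (ex r A) g u ¬gr ¬sc nvC nvD =
    solved-progress st _ u g (atomicDecC ¬gr ¬sc nvC nvD (¬GroundAtoms ¬gr) (inj₁ (c , refl)))
  atomicDecomposition-progress st (ex r A) (at (con d)) g u ¬gr ¬sc nvC nvD =
    solved-progress st _ u g (atomicDecC ¬gr ¬sc nvC nvD (¬GroundAtoms ¬gr) (inj₂ (d , refl)))
  atomicDecomposition-progress st (ex r A) (ex s B) g u ¬gr ¬sc nvC nvD with r ℕ.≟ s
  ... | no r≢s = solved-progress st _ u g (atomicDecD ¬gr ¬sc (¬GroundAtoms ¬gr) r≢s)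
  atomicDecomposition-progress st (ex r A) (ex .r B) g@(I , G , _) u ¬gr ¬sc nvC nvD | yes refl
    with wellFormed I (proj₁ u)
  ... | lo , _ , refl , pB =
    _ , eagerStep u (atomicDecE ¬gr ¬sc (¬GroundAtoms ¬gr)) ,
    markSolved-Guided _ _ (Guided-Preservation.expandDec-pres A B st₁ (addE-Guided st _ (w , A⋢B) g)) ,
    markSolved-progress st _ _ (≼-trans (addE-≼ _ st) (≼-Preservation.expandDec-pres st₁ A B st₁ ≼-refl))
      u (lo , _ , refl , pB)
    where
    st₁ : State
    st₁ = addE (dis [ at A ] [ at B ]) st
    w : WF (dis [ at A ] [ at B ])
    w = AdmissibleLhs-single (InAt-∃ (AdmissibleLhs-InAt lo (here refl))) , at B , refl , InAt-∃ pB
    A⋢B : ¬ (applyA σ (at A) ⊑ applyA σ (at B))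
    A⋢B k = G _ (proj₁ u) (subst₂ _⊑_ (sym (applyA-∃ σ r A)) (sym (applyA-∃ σ r B))
                           (∃c-mono-⊑ {r} {applyA σ (at A)} {applyA σ (at B)} k))

  leftDecomposition-progress : ∀ st Cs D → Guided st → Unsolved st (dis Cs [ D ]) →
    ¬ GroundElem (dis Cs [ D ]) → ¬ SolvApp (S st) (dis Cs [ D ]) → length Cs ≢ 1 → NonVar D →
    Progress st
  leftDecomposition-progress st Cs D g@(I , G , _) u ¬gr ¬sc len nvD with wellFormed I (proj₁ u)
  ... | lo , _ , refl , pD =
    _ , eagerStep u (leftDecomposition ¬gr ¬sc len nvD) ,
    markSolved-Guided _ _ (Guided-Preservation.leftDec-pres D Cs st part g) ,
    markSolved-progress st _ _ (≼-Preservation.leftDec-pres st D Cs st (λ _ _ → tt) ≼-refl) u (lo , D , refl , pD)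
    where
    part : ∀ C → C ∈ Cs → WF (dis [ C ] [ D ]) × Solves σ (dis [ C ] [ D ])
    part C C∈ = (AdmissibleLhs-single (AdmissibleLhs-InAt lo C∈) , D , refl , pD) ,
                (λ k → G _ (proj₁ u) (⊑-trans {applyL σ Cs} {applyA σ C} {applyA σ D} (applyL-⊑-∈ σ C∈) k))

  ExtCond-⊑ : ∀ st {Cs X} → σ-below-S st → ExtCond (S st) Cs X → σ X ⊑ applyL σ Cs
  ExtCond-⊑ st {Cs} {X} H (_ , covered) = ⨅-greatest {σ X} (map (applyA σ) Cs) below
    where
    below : ∀ c → c ∈ map (applyA σ) Cs → σ X ⊑ c
    below c c∈ with ∈-map⁻ (applyA σ) c∈
    ... | C , C∈ , refl with covered C C∈
    ...   | inj₁ refl = ⊑-refl {σ X}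
    ...   | inj₂ C∈S = H C∈S

  eager-sub-progress : ∀ st Cs D → Guided st → Unsolved st (sub Cs D) → ¬ GroundElem (sub Cs D) →
                       Progress st ⊎ ¬ EagerApplicable st (sub Cs D)
  eager-sub-progress st Cs D g@(I , G , H) u ¬gr with SolvCond? (S st) Cs D
  ... | yes sc = inj₁ (solved-progress st _ u g (solving ¬gr sc))
  ... | no ¬sc with ExtCond? (S st) Cs
  ...   | no ¬ext = inj₂ (¬EagerApplicable-sub st ¬gr ¬sc ¬ext)
  ...   | yes (X , ext)
    with extension-progress st Cs D X g u (proj₁ ext)
           (⊑-trans {σ X} {applyL σ Cs} {applyA σ D} (ExtCond-⊑ st H ext) (G _ (proj₁ u)))
  ...     | ac , g' , fewer = inj₁ (_ , eagerStep u (extension ¬gr ¬sc ext ac) , g' , fewer)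

  eager-dis-progress : ∀ st Cs D → Guided st → Unsolved st (dis Cs [ D ]) → ¬ GroundElem (dis Cs [ D ]) →
                       Progress st ⊎ ¬ EagerApplicable st (dis Cs [ D ])
  eager-dis-progress st Cs D g@(I , G , H) u ¬gr with SolvCond? (S st) Cs D
  ... | yes sc = ⊥-elim (G _ (proj₁ u) (SolvCond-⊑ st H sc))
  ... | no ¬sc with NonVar? D
  ...   | no varD =
    inj₂ (¬EagerApplicable-dis st ¬gr ¬sc (λ ld → varD (proj₂ ld)) (λ ad → varD (ADApp⇒NonVar Cs ad)))
  ...   | yes nvD with singleton? Cs
  ...     | inj₂ len = inj₁ (leftDecomposition-progress st Cs D g u ¬gr ¬sc len nvD)
  ...     | inj₁ (C , refl) with NonVar? C
  ...       | yes nvC = inj₁ (atomicDecomposition-progress st C D g u ¬gr ¬sc nvC nvD)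
  ...       | no varC =
    inj₂ (¬EagerApplicable-dis st ¬gr ¬sc (λ ld → proj₁ ld refl) (λ ad → varC (proj₁ ad)))

  eager-progress : ∀ st e → Guided st → Unsolved st e → Progress st ⊎ ¬ EagerApplicable st e
  eager-progress st e g@(I , G , H) u with GroundElem? e
  ... | yes gr = inj₁ (solved-progress st e u g (groundSolving gr (Guided-HoldsGround st e G (proj₁ u) gr)))
  eager-progress st (sub Cs D) g u | no ¬gr = eager-sub-progress st Cs D g u ¬gr
  eager-progress st (dis Cs Ds) g@(I , _) u | no ¬gr with wellFormed I (proj₁ u)
  ... | _ , D , refl , _ = eager-dis-progress st Cs D g u ¬gr

  NoEager : State → Set
  NoEager st = ∀ e → Unsolved st e → ¬ EagerApplicable st e

  decomposition-progress : ∀ st Cs r A B → Guided st → Unsolved st (sub Cs (ex r B)) → NoEager st →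
    ex r A ∈ Cs → applyA σ (at A) ⊑ applyA σ (at B) → Progress st
  decomposition-progress st Cs r A B g@(I , _) u none A∈ A⊑B with wellFormed I (proj₁ u)
  ... | lo , pD =
    _ , nondetStep none u (decomposition A∈) ,
    markSolved-Guided _ _ (Guided-Preservation.expandIfVar-pres (at B) st₁ (addE-Guided st _ (w , A⊑B) g)) ,
    markSolved-progress st _ _ (≼-trans (addE-≼ _ st) (≼-Preservation.expandIfVar-pres st₁ (at B) st₁ ≼-refl))
      u (lo , pD)
    where
    st₁ : State
    st₁ = addE (sub [ at A ] (at B)) st
    w : WF (sub [ at A ] (at B))
    w = AdmissibleLhs-single (InAt-∃ (AdmissibleLhs-InAt lo A∈)) , InAt-∃ pD

  subsumption-progress : ∀ st Cs D C → Guided st → Unsolved st (sub Cs D) → NoEager st →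
                         C ∈ Cs → applyA σ C ⊑ applyA σ D → Progress st
  subsumption-progress st Cs D (at (var X)) g u none X∈ X⊑D with extension-progress st Cs D X g u X∈ X⊑D
  ... | ac , g' , fewer = _ , nondetStep none u (extension X∈ ac) , g' , fewer
  subsumption-progress st Cs (at (var Y)) (at (con c)) (I , _) u _ _ _ = ⊥-elim (unsolved-sub-NonVar I u (isVar Y))
  subsumption-progress st Cs (at (con d)) (at (con c)) g u none c∈ c⊑d with nm⊑nm⇒≡ c⊑d
  ... | refl = ⊥-elim (none _ u (inj₂ (inj₁ (at (con c) , c∈ , inj₁ refl))))
  subsumption-progress st Cs (ex s B) (at (con c)) g u none _ c⊑ =
    ⊥-elim (nm⋢∃c {con c} {s} {applyA σ (at B)} (subst (nm (con c) ⊑_) (applyA-∃ σ s B) c⊑))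
  subsumption-progress st Cs (at (var Y)) (ex r A) (I , _) u _ _ _ = ⊥-elim (unsolved-sub-NonVar I u (isVar Y))
  subsumption-progress st Cs (at (con d)) (ex r A) g u none _ ⊑d =
    ⊥-elim (∃c⋢nm {con d} {r} {applyA σ (at A)} (subst (_⊑ nm (con d)) (applyA-∃ σ r A) ⊑d))
  subsumption-progress st Cs (ex s B) (ex r A) g u none A∈ ⊑
    with ∃c⊑∃c⇒ {r} {s} {applyA σ (at A)} {applyA σ (at B)}
           (subst₂ _⊑_ (applyA-∃ σ r A) (applyA-∃ σ s B) ⊑)
  ... | refl , A⊑B = decomposition-progress st Cs r A B g u none A∈ A⊑B

  -- σ(X) is the conjunction of σ(S₀ X), so σ(Cs) ⋢ σ(X) is witnessed by some E ∈ S₀ X.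
  localSolution-witness : ∀ Cs X → InVar Γ₀ X → ¬ (applyL σ Cs ⊑ σ X) →
                          Σ FAtom λ E → E ∈ S₀ X × ¬ (applyL σ Cs ⊑ applyA σ E)
  localSolution-witness Cs X pX ⋢X with Any∈? (λ E → ¬? (applyL σ Cs ⊑? applyA σ E)) (S₀ X)
  ... | yes w = w
  ... | no none = ⊥-elim (⋢X (subst (applyL σ Cs ⊑_) (sym (σ-local X pX))
                               (⨅-greatest {applyL σ Cs} (map (applyA σ) (S₀ X)) below)))
    where
    below : ∀ c → c ∈ map (applyA σ) (S₀ X) → applyL σ Cs ⊑ c
    below c c∈ with ∈-map⁻ (applyA σ) c∈
    ... | E , E∈ , refl = decidable-stable (applyL σ Cs ⊑? applyA σ E) (λ ⋢ → none (E , E∈ , ⋢))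

  localExtension-progress : ∀ st Cs X → Guided st → Unsolved st (dis Cs [ at (var X) ]) → NoEager st →
                            Progress st
  localExtension-progress st Cs X g@(I , G , _) u none with wellFormed I (proj₁ u)
  ... | lo , _ , refl , pX with localSolution-witness Cs X pX (G _ (proj₁ u))
  ...   | E , E∈ , Cs⋢E with addS-Guided st X E pE pX X⊑E g
    where
    pE : InAtNv Γ₀ E
    pE = proj₁ (S₀-assignment X) pX E E∈
    X⊑E : σ X ⊑ applyA σ E
    X⊑E = subst (_⊑ applyA σ E) (sym (σ-local X pX)) (applyL-⊑-∈ σ E∈)
  ...     | ac , g₁ =
    _ , nondetStep none u (localExtension pE ac) , markSolved-Guided _ _ g₄ ,
    markSolved-progress st _ _ st≼st₄ u (lo , at (var X) , refl , pX)
    where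
    pE : InAtNv Γ₀ E
    pE = proj₁ (S₀-assignment X) pX E E∈
    st₁ st₂ st₃ : State
    st₁ = setS (addS X E (S st)) st
    st₂ = addE (dis Cs [ E ]) st₁
    st₃ = expand X st₂
    g₄ : Guided (expandIfVarL Cs st₃)
    g₄ = Guided-Preservation.expandIfVarL-pres Cs st₃
           (expand-Guided st₂ X (addE-Guided st₁ _ ((lo , E , refl , proj₁ pE) , Cs⋢E) g₁))
    st≼st₄ : st ≼ expandIfVarL Cs st₃
    st≼st₄ = ≼-trans (addS-≼ X E st) (≼-trans (addE-≼ _ st₁)
               (≼-trans (expand-≼ X st₂) (≼-Preservation.expandIfVarL-pres st₃ Cs st₃ ≼-refl)))

  nondet-dis-progress : ∀ st Cs D → Guided st → Unsolved st (dis Cs [ D ]) → NoEager st → Progress st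
  nondet-dis-progress st Cs D g@(I , _) u none with NonVar? D
  ... | no varD with ¬NonVar⇒var varD
  ...   | X , refl = localExtension-progress st Cs X g u none
  nondet-dis-progress st Cs D g@(I , _) u none | yes nvD with singleton? Cs
  ...   | inj₂ len = ⊥-elim (none _ u (inj₂ (inj₂ (inj₂ (inj₂ (inj₁ (len , nvD)))))))
  ...   | inj₁ (C , refl) with NonVar? C
  ...     | yes nvC = ⊥-elim (none _ u (inj₂ (inj₂ (inj₂ (inj₂ (inj₂ (nvC , nvD)))))))
  ...     | no varC with ¬NonVar⇒var varC
  ...       | Y , refl = ⊥-elim (unsolved-¬initSolved I u (NonVar⇒initSolved {Y} nvD))

  nondet-progress : ∀ st e → Guided st → Unsolved st e → NoEager st → Progress st
  nondet-progress st (sub Cs D) g@(I , G , _) u none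
    with ⨅-⊑-Atomic (map (applyA σ) Cs) (applyA-Atomic σ (unsolved-sub-NonVar I u)) (G _ (proj₁ u))
  ... | c , c∈ , c⊑ with ∈-map⁻ (applyA σ) c∈
  ...   | C , C∈ , refl = subsumption-progress st Cs D C g u none C∈ c⊑
  nondet-progress st (dis Cs Ds) g@(I , _) u none with wellFormed I (proj₁ u)
  ... | _ , D , refl , _ = nondet-dis-progress st Cs D g u none

  eager-scan : ∀ st → Guided st → ∀ xs → (∀ {e} → e ∈ xs → e ∈ Γ st) →
               Progress st ⊎ (∀ e → e ∈ xs → Unsolved st e → ¬ EagerApplicable st e)
  eager-scan st g [] _ = inj₂ λ e ()
  eager-scan st g (x ∷ xs) ⊆Γ with eager-scan st g xs (λ m → ⊆Γ (there m))
  ... | inj₁ p = inj₁ p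
  ... | inj₂ rest with x ∈E? Sol st
  ...   | yes x∈Sol = inj₂ λ { e (here refl) u → ⊥-elim (proj₂ u x∈Sol) ; e (there m) u → rest e m u }
  ...   | no x∉Sol with eager-progress st x g (⊆Γ (here refl) , x∉Sol)
  ...     | inj₁ p = inj₁ p
  ...     | inj₂ ¬app = inj₂ λ { e (here refl) _ → ¬app ; e (there m) u → rest e m u }

  run : ∀ st → Acc _<_ (countOutside candidates (Sol st)) → Guided st → SuccessfulRun Γ₀ st
  run st (acc rec) g with Any∈? (λ e → ¬? (e ∈E? Sol st)) (Γ st)
  ... | no allSolved = done (λ e m → decidable-stable (e ∈E? Sol st) (λ e∉ → allSolved (e , m , e∉)))
  ... | yes (e , e∈ , e∉) with eager-scan st g (Γ st) (λ m → m)
  ...   | inj₁ (st' , s , g' , fewer) = step s (run st' (rec fewer) g')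
  ...   | inj₂ noEager with nondet-progress st e g (e∈ , e∉) (λ e' u → noEager e' (proj₁ u) u)
  ...     | st' , s , g' , fewer = step s (run st' (rec fewer) g')

completeness : ∀ Γ₀ → SingleRHS Γ₀ → HasLocalSolution Γ₀ → SuccessfulRun Γ₀ (initState Γ₀)
completeness Γ₀ single (S₀ , S₀-assignment , _ , σ , σ-local , _ , solves) =
  Completeness.run Γ₀ S₀ S₀-assignment σ σ-local (initState Γ₀) (<-wellFounded _)
    (initState-Invariant Γ₀ single , solves , λ ())

theorem5p8 : (Γ₀ : Problem) → SingleRHS Γ₀ →
    HasLocalSolution Γ₀ ⇔ SuccessfulRun Γ₀ (initState Γ₀)
theorem5p8 Γ₀ single = mk⇔ (completeness Γ₀ single) (soundness Γ₀ single)
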